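{- Let $R=R_1\times R_2\times\cdots\times R_s$, where each $R_i$ is a finite local ring with maximal ideal $M_i$ of order $m_i$, and where $|R_1|/m_1\le\cdots\le |R_s|/m_s$. Then the numbers of triangles in $G_R$ and in its line graph are $$n_3(G_R)=\frac16|R^\times||R|\prod_{i=1}^s\left(|R_i^\times|-m_i\right),$$ $$n_3(\mathcal{L}(G_R))=\frac16|R^\times||R|\left(\prod_{i=1}^s\left(|R_i^\times|-m_i\right)+(|R^\times|-1)(|R^\times|-2)\right).$$
   Context: Rings are commutative with identity $1\neq 0$. For a finite commutative ring $R$, $R^\times$ denotes its group of units. The unitary Cayley graph $G_R$ is the graph with vertex set $R$ in which $x,y\in R$ are adjacent iff $x-y\in R^\times$. A local ring is a commutative ring with a unique maximal ideal. The line graph $\mathcal{L}(G)$ of a graph $G$ has the edges of $G$ as vertices, two being adjacent iff they share an end-vertex. $n_3(G)$ denotes the number of triangles in a graph $G$. -}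

module Defs where

open import Data.Nat as ℕ using (ℕ; zero; suc)
open import Data.Fin as Fin using (Fin)
open import Data.Fin.Properties using (any?) renaming (_≟_ to _≟F_)
open import Data.Fin.Subset using (Subset; _∈_; _⊆_; ⊤; ∣_∣)
open import Data.List using (List; []; _∷_; [_]; map; concatMap; length; filter; allFin; lookup; foldr)
open import Data.Product using (Σ; _×_; _,_)
open import Data.Sum using (_⊎_)
open import Relation.Nullary using (Dec; yes; no; ¬_)
open import Relation.Nullary.Decidable using (_×-dec_; _⊎-dec_; ¬?)
open import Relation.Unary using (Pred) renaming (Decidable to Decidable₁)
open import Relation.Binary.PropositionalEquality using (_≡_; _≢_; refl; cong₂)
open import Algebra.Structures using (IsCommutativeRing)
open import Data.Integer as ℤ using (ℤ; +_)

record FinCRing : Set where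
  field
    size : ℕ
    _+_ _*_ : Fin size → Fin size → Fin size
    -_ : Fin size → Fin size
    0# 1# : Fin size
    isCommRing : IsCommutativeRing _≡_ _+_ _*_ -_ 0# 1#
    1≢0 : 1# ≢ 0#

  Carrier : Set
  Carrier = Fin size

  IsUnit : Carrier → Set
  IsUnit x = Σ Carrier λ y → x * y ≡ 1#

  isUnit? : Decidable₁ IsUnit
  isUnit? x = any? (λ y → (x * y) ≟F 1#)

  unitCount : ℕ
  unitCount = length (filter isUnit? (allFin size))

  record IsIdeal (I : Subset size) : Set where
    field
      0∈ : 0# ∈ I
      +-closed : ∀ {x y} → x ∈ I → y ∈ I → (x + y) ∈ I
      neg-closed : ∀ {x} → x ∈ I → (- x) ∈ I
      *-closed : ∀ r {x} → x ∈ I → (r * x) ∈ I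

  record IsMaximalIdeal (M : Subset size) : Set where
    field
      ideal : IsIdeal M
      proper : M ≢ ⊤
      maximal : ∀ J → IsIdeal J → M ⊆ J → J ≡ M ⊎ J ≡ ⊤

record FinLocalRing : Set where
  field
    ring : FinCRing
  open FinCRing ring
  field
    M : Subset size
    M-maximal : IsMaximalIdeal M
    M-unique : ∀ J → IsMaximalIdeal J → J ≡ M

  m : ℕ
  m = ∣ M ∣

open FinLocalRing

sz : FinLocalRing → ℕ
sz R = FinCRing.size (ring R)

data Elt : List FinLocalRing → Set where
  [] : Elt []
  _∷_ : ∀ {R Rs} → Fin (sz R) → Elt Rs → Elt (R ∷ Rs)

addP : ∀ {Rs} → Elt Rs → Elt Rs → Elt Rs
addP [] [] = []
addP {R ∷ _} (a ∷ x) (b ∷ y) = FinCRing._+_ (ring R) a b ∷ addP x y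

mulP : ∀ {Rs} → Elt Rs → Elt Rs → Elt Rs
mulP [] [] = []
mulP {R ∷ _} (a ∷ x) (b ∷ y) = FinCRing._*_ (ring R) a b ∷ mulP x y

negP : ∀ {Rs} → Elt Rs → Elt Rs
negP [] = []
negP {R ∷ _} (a ∷ x) = FinCRing.-_ (ring R) a ∷ negP x

oneP : ∀ {Rs} → Elt Rs
oneP {[]} = []
oneP {R ∷ _} = FinCRing.1# (ring R) ∷ oneP

subP : ∀ {Rs} → Elt Rs → Elt Rs → Elt Rs
subP x y = addP x (negP y)

elts : (Rs : List FinLocalRing) → List (Elt Rs)
elts [] = [ [] ]
elts (R ∷ Rs) = concatMap (λ a → map (a ∷_) (elts Rs)) (allFin (sz R))

_≟E_ : ∀ {Rs} (x y : Elt Rs) → Dec (x ≡ y)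
[] ≟E [] = yes refl
(a ∷ x) ≟E (b ∷ y) with a ≟F b | x ≟E y
... | yes refl | yes refl = yes refl
... | no a≢b | _ = no λ { refl → a≢b refl }
... | yes _ | no x≢y = no λ { refl → x≢y refl }

anyElt? : ∀ {Rs} {P : Elt Rs → Set} → Decidable₁ P → Dec (Σ (Elt Rs) P)
anyElt? {[]} P? with P? []
... | yes p = yes ([] , p)
... | no ¬p = no λ { ([] , p) → ¬p p }
anyElt? {R ∷ Rs} {P} P? with any? (λ a → anyElt? {Rs} {λ ys → P (a ∷ ys)} (λ ys → P? (a ∷ ys)))
... | yes (a , ys , p) = yes (a ∷ ys , p)
... | no ¬q = no λ { (a ∷ ys , p) → ¬q (a , ys , p) }

IsUnitP : ∀ {Rs} → Elt Rs → Set
IsUnitP {Rs} x = Σ (Elt Rs) λ y → mulP x y ≡ oneP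

isUnitP? : ∀ {Rs} → Decidable₁ (IsUnitP {Rs})
isUnitP? x = anyElt? (λ y → mulP x y ≟E oneP)

cardR : List FinLocalRing → ℕ
cardR Rs = length (elts Rs)

unitsR : List FinLocalRing → ℕ
unitsR Rs = length (filter isUnitP? (elts Rs))

record FinGraph : Set₁ where
  field
    V : ℕ
    Adj : Fin V → Fin V → Set
    adj? : ∀ i j → Dec (Adj i j)

open FinGraph

pairs : (n : ℕ) → List (Fin n × Fin n)
pairs n = concatMap (λ i → map (i ,_) (allFin n)) (allFin n)

triples : (n : ℕ) → List (Fin n × Fin n × Fin n)
triples n = concatMap (λ i → map (λ jk → (i , jk)) (pairs n)) (allFin n)

IsTriangle : (G : FinGraph) → Fin (V G) × Fin (V G) × Fin (V G) → Set
IsTriangle G (i , j , k) =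
  (i Fin.< j × j Fin.< k) × (Adj G i j × Adj G j k × Adj G i k)

n3 : FinGraph → ℕ
n3 G = length (filter (λ { (i , j , k) →
         (i Fin.<? j ×-dec j Fin.<? k) ×-dec
         (adj? G i j ×-dec adj? G j k ×-dec adj? G i k) })
       (triples (V G)))

IsEdge : (G : FinGraph) → Fin (V G) × Fin (V G) → Set
IsEdge G (i , j) = i Fin.< j × Adj G i j

edges : (G : FinGraph) → List (Fin (V G) × Fin (V G))
edges G = filter (λ { (i , j) → i Fin.<? j ×-dec adj? G i j }) (pairs (V G))

ShareEnd : ∀ {n} → Fin n × Fin n → Fin n × Fin n → Set
ShareEnd (a , b) (c , d) = a ≡ c ⊎ a ≡ d ⊎ b ≡ c ⊎ b ≡ d

shareEnd? : ∀ {n} (e f : Fin n × Fin n) → Dec (ShareEnd e f)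
shareEnd? (a , b) (c , d) = a ≟F c ⊎-dec a ≟F d ⊎-dec b ≟F c ⊎-dec b ≟F d

lineGraph : FinGraph → FinGraph
lineGraph G = record
  { V = length (edges G)
  ; Adj = λ e f → e ≢ f × ShareEnd (lookup (edges G) e) (lookup (edges G) f)
  ; adj? = λ e f → ¬? (e ≟F f) ×-dec shareEnd? (lookup (edges G) e) (lookup (edges G) f)
  }

unitaryCayley : List FinLocalRing → FinGraph
unitaryCayley Rs = record
  { V = cardR Rs
  ; Adj = λ k l → IsUnitP (subP (lookup (elts Rs) k) (lookup (elts Rs) l))
  ; adj? = λ k l → isUnitP? (subP (lookup (elts Rs) k) (lookup (elts Rs) l))
  }

prodTerm : List FinLocalRing → ℤ
prodTerm = foldr (λ R acc → ((+ FinCRing.unitCount (ring R)) ℤ.- (+ m R)) ℤ.* acc) (+ 1)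

-- |R_1|/m_1 ≤ |R_2|/m_2, written without division (m_i ≥ 1)
RatioLE : FinLocalRing → FinLocalRing → Set
RatioLE R S = sz R ℕ.* m S ℕ.≤ sz S ℕ.* m R

module Submission where

-- Two graph-theoretic counts follow:
--   * for a loopless undirected graph G, 6 n₃(G) is the number of ordered triangles;
--   * for such a G that is k-regular on n vertices, 6 n₃(L(G)) = n k(k-1)(k-2) + 6 n₃(G),
--     since three mutually adjacent edges either form a star at one vertex or a triangle.
-- On the ring side, a proper ideal of a finite ring lies in a maximal ideal; hence in a
-- local ring the units are exactly the elements outside M, |R^×| + m = |R|, and two adjacent
-- vertices of G_R have κ = |R^×| - m common neighbours. Being a unit is componentwise in a
-- product, so G_R is |R^×|-regular with |R| |R^×| ∏ κ(R_i) ordered triangles, and the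
-- corollary is the resulting arithmetic in ℤ.

open import Defs
open import Data.Bool using (true; false; if_then_else_)
open import Data.Empty using (⊥; ⊥-elim)
open import Data.Nat using (ℕ)
open import Data.Fin as F using (Fin; zero; suc)
open import Data.Fin.Properties using () renaming (_≟_ to _≟F_)
import Data.Fin.Properties as FinP
import Data.Fin.Permutation as Perm
open import Data.List using (List; []; _∷_; map; concatMap; filter; allFin; tabulate; length; lookup; _++_; cartesianProduct)
open import Data.List.Properties using (tabulate-lookup)
open import Data.Product using (Σ; _×_; _,_; proj₁; proj₂)
open import Data.Sum using (_⊎_; inj₁; inj₂)
open import Function using (_∘_)
open import Relation.Nullary using (Dec; yes; no; ¬_; does)
open import Relation.Nullary.Decidable using (_×-dec_; _⊎-dec_; ¬?)
open import Relation.Unary using () renaming (Decidable to Decidable₁)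
open import Relation.Binary.PropositionalEquality
  using (_≡_; _≢_; refl; sym; trans; cong; cong₂; subst; subst₂; module ≡-Reasoning)

-- Indicators and 0/1-valued numbers

module Indicators where
  open import Data.Nat using (_+_; _*_)
  open import Data.Nat.Properties using (*-zeroʳ; m*n≡1⇒m≡1; m*n≡1⇒n≡1)

  𝟙 : ∀ {p} {P : Set p} → Dec P → ℕ
  𝟙 d = if does d then 1 else 0

  𝟙-yes : ∀ {p} {P : Set p} (d : Dec P) → P → 𝟙 d ≡ 1
  𝟙-yes (yes _) _ = refl
  𝟙-yes (no ¬p) p = ⊥-elim (¬p p)

  𝟙-no : ∀ {p} {P : Set p} (d : Dec P) → ¬ P → 𝟙 d ≡ 0
  𝟙-no (yes p) ¬p = ⊥-elim (¬p p)
  𝟙-no (no _) _ = refl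

  𝟙≡1⇒ : ∀ {p} {P : Set p} (d : Dec P) → 𝟙 d ≡ 1 → P
  𝟙≡1⇒ (yes p) _ = p
  𝟙≡1⇒ (no _) ()

  𝟙≡0⇒ : ∀ {p} {P : Set p} (d : Dec P) → 𝟙 d ≡ 0 → ¬ P
  𝟙≡0⇒ (yes _) ()
  𝟙≡0⇒ (no ¬p) _ = ¬p

  𝟙-iff : ∀ {p q} {P : Set p} {Q : Set q} (d : Dec P) (e : Dec Q) → (P → Q) → (Q → P) → 𝟙 d ≡ 𝟙 e
  𝟙-iff (yes p) e f g = sym (𝟙-yes e (f p))
  𝟙-iff (no ¬p) e f g = sym (𝟙-no e (λ q → ¬p (g q)))

  𝟙-× : ∀ {p q} {P : Set p} {Q : Set q} (d : Dec P) (e : Dec Q) → 𝟙 (d ×-dec e) ≡ 𝟙 d * 𝟙 e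
  𝟙-× (yes _) (yes _) = refl
  𝟙-× (yes _) (no _) = refl
  𝟙-× (no _) _ = refl

  𝟙-¬ : ∀ {p} {P : Set p} (d : Dec P) → 𝟙 (¬? d) + 𝟙 d ≡ 1
  𝟙-¬ (yes _) = refl
  𝟙-¬ (no _) = refl

  𝟙-⊎₄ : ∀ {a b c d} {P₁ : Set a} {P₂ : Set b} {P₃ : Set c} {P₄ : Set d}
    (d₁ : Dec P₁) (d₂ : Dec P₂) (d₃ : Dec P₃) (d₄ : Dec P₄) →
    ¬ (P₁ × P₂) → ¬ (P₁ × P₃) → ¬ (P₁ × P₄) → ¬ (P₂ × P₃) → ¬ (P₂ × P₄) → ¬ (P₃ × P₄) →
    𝟙 (d₁ ⊎-dec d₂ ⊎-dec d₃ ⊎-dec d₄) ≡ (𝟙 d₁ + 𝟙 d₂) + (𝟙 d₃ + 𝟙 d₄)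
  𝟙-⊎₄ (yes p) (yes q) _ _ n₁₂ _ _ _ _ _ = ⊥-elim (n₁₂ (p , q))
  𝟙-⊎₄ (yes p) (no _) (yes r) _ _ n₁₃ _ _ _ _ = ⊥-elim (n₁₃ (p , r))
  𝟙-⊎₄ (yes p) (no _) (no _) (yes s) _ _ n₁₄ _ _ _ = ⊥-elim (n₁₄ (p , s))
  𝟙-⊎₄ (yes p) (no _) (no _) (no _) _ _ _ _ _ _ = refl
  𝟙-⊎₄ (no _) (yes q) (yes r) _ _ _ _ n₂₃ _ _ = ⊥-elim (n₂₃ (q , r))
  𝟙-⊎₄ (no _) (yes q) (no _) (yes s) _ _ _ _ n₂₄ _ = ⊥-elim (n₂₄ (q , s))
  𝟙-⊎₄ (no _) (yes q) (no _) (no _) _ _ _ _ _ _ = refl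
  𝟙-⊎₄ (no _) (no _) (yes r) (yes s) _ _ _ _ _ n₃₄ = ⊥-elim (n₃₄ (r , s))
  𝟙-⊎₄ (no _) (no _) (yes r) (no _) _ _ _ _ _ _ = refl
  𝟙-⊎₄ (no _) (no _) (no _) (yes s) _ _ _ _ _ _ = refl
  𝟙-⊎₄ (no _) (no _) (no _) (no _) _ _ _ _ _ _ = refl

  Bit : ℕ → Set
  Bit x = x ≡ 0 ⊎ x ≡ 1

  bit-𝟙 : ∀ {p} {P : Set p} (d : Dec P) → Bit (𝟙 d)
  bit-𝟙 (yes _) = inj₂ refl
  bit-𝟙 (no _) = inj₁ refl

  bit-* : ∀ {x y} → Bit x → Bit y → Bit (x * y)
  bit-* (inj₁ refl) _ = inj₁ refl
  bit-* (inj₂ refl) (inj₁ refl) = inj₁ refl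
  bit-* (inj₂ refl) (inj₂ refl) = inj₂ refl

  bit-square : ∀ {x} → Bit x → x * x ≡ x
  bit-square (inj₁ refl) = refl
  bit-square (inj₂ refl) = refl

  *≡1 : ∀ x y → x * y ≡ 1 → x ≡ 1 × y ≡ 1
  *≡1 x y e = m*n≡1⇒m≡1 x y e , m*n≡1⇒n≡1 x y e

  bit-*-cong : ∀ {x} y z → Bit x → (x ≡ 1 → y ≡ z) → x * y ≡ x * z
  bit-*-cong y z (inj₁ refl) h = refl
  bit-*-cong y z (inj₂ refl) h = cong (1 *_) (h refl)

  bit-absorb : ∀ {y} x → Bit y → (y ≡ 1 → x ≡ 1) → x * y ≡ y
  bit-absorb x (inj₁ refl) h = *-zeroʳ x
  bit-absorb x (inj₂ refl) h rewrite h refl = refl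

-- Finite sums: over a list, over Fin n, and triple sums over Fin n

module Sums where
  open import Data.Nat using (zero; suc; _+_; _*_)
  open import Data.Nat.Properties
    using (+-identityʳ; +-assoc; *-zeroʳ; *-identityʳ; *-comm; *-assoc; *-distribˡ-+; +-commutativeSemigroup; +-0-commutativeMonoid)
  open import Algebra.Properties.CommutativeSemigroup +-commutativeSemigroup using (interchange)
  import Algebra.Properties.CommutativeMonoid.Sum +-0-commutativeMonoid as MonoidSum
  open Indicators

  ∑ : ∀ {a} {A : Set a} → List A → (A → ℕ) → ℕ
  ∑ [] f = 0
  ∑ (x ∷ xs) f = f x + ∑ xs f

  module _ {a} {A : Set a} where
    ∑-cong : ∀ (xs : List A) {f g : A → ℕ} → (∀ x → f x ≡ g x) → ∑ xs f ≡ ∑ xs g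
    ∑-cong [] h = refl
    ∑-cong (x ∷ xs) h = cong₂ _+_ (h x) (∑-cong xs h)

    ∑-+ : ∀ (xs : List A) (f g : A → ℕ) → ∑ xs (λ x → f x + g x) ≡ ∑ xs f + ∑ xs g
    ∑-+ [] f g = refl
    ∑-+ (x ∷ xs) f g = trans (cong (f x + g x +_) (∑-+ xs f g)) (interchange (f x) (g x) (∑ xs f) (∑ xs g))

    ∑-zero : ∀ (xs : List A) → ∑ xs (λ _ → 0) ≡ 0
    ∑-zero [] = refl
    ∑-zero (x ∷ xs) = ∑-zero xs

    ∑-*ˡ : ∀ (xs : List A) c (f : A → ℕ) → ∑ xs (λ x → c * f x) ≡ c * ∑ xs f
    ∑-*ˡ [] c f = sym (*-zeroʳ c)
    ∑-*ˡ (x ∷ xs) c f = trans (cong (c * f x +_) (∑-*ˡ xs c f)) (sym (*-distribˡ-+ c (f x) (∑ xs f)))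

    ∑-*ʳ : ∀ (xs : List A) c (f : A → ℕ) → ∑ xs (λ x → f x * c) ≡ ∑ xs f * c
    ∑-*ʳ xs c f = trans (∑-cong xs (λ x → *-comm (f x) c)) (trans (∑-*ˡ xs c f) (*-comm c (∑ xs f)))

    ∑-++ : ∀ (xs ys : List A) (f : A → ℕ) → ∑ (xs ++ ys) f ≡ ∑ xs f + ∑ ys f
    ∑-++ [] ys f = refl
    ∑-++ (x ∷ xs) ys f = trans (cong (f x +_) (∑-++ xs ys f)) (sym (+-assoc (f x) (∑ xs f) (∑ ys f)))

    length-∑ : ∀ (xs : List A) → length xs ≡ ∑ xs (λ _ → 1)
    length-∑ [] = refl
    length-∑ (x ∷ xs) = cong suc (length-∑ xs)

    ∑-filter : ∀ {p} {P : A → Set p} (P? : Decidable₁ P) (xs : List A) (f : A → ℕ) →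
      ∑ (filter P? xs) f ≡ ∑ xs (λ x → 𝟙 (P? x) * f x)
    ∑-filter P? [] f = refl
    ∑-filter P? (x ∷ xs) f with P? x
    ... | yes _ = cong₂ _+_ (sym (+-identityʳ (f x))) (∑-filter P? xs f)
    ... | no _ = ∑-filter P? xs f

    length-filter-∑ : ∀ {p} {P : A → Set p} (P? : Decidable₁ P) (xs : List A) →
      length (filter P? xs) ≡ ∑ xs (λ x → 𝟙 (P? x))
    length-filter-∑ P? xs =
      trans (length-∑ (filter P? xs)) (trans (∑-filter P? xs (λ _ → 1)) (∑-cong xs (λ x → *-identityʳ _)))

  module _ {a b} {A : Set a} {B : Set b} where
    ∑-map : ∀ (g : A → B) (xs : List A) (f : B → ℕ) → ∑ (map g xs) f ≡ ∑ xs (f ∘ g)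
    ∑-map g [] f = refl
    ∑-map g (x ∷ xs) f = cong (f (g x) +_) (∑-map g xs f)

    ∑-concatMap : ∀ (g : A → List B) (xs : List A) (f : B → ℕ) →
      ∑ (concatMap g xs) f ≡ ∑ xs (λ x → ∑ (g x) f)
    ∑-concatMap g [] f = refl
    ∑-concatMap g (x ∷ xs) f =
      trans (∑-++ (g x) (concatMap g xs) f) (cong (∑ (g x) f +_) (∑-concatMap g xs f))

    ∑-swap : ∀ (xs : List A) (ys : List B) (f : A → B → ℕ) →
      ∑ xs (λ x → ∑ ys (f x)) ≡ ∑ ys (λ y → ∑ xs (λ x → f x y))
    ∑-swap [] ys f = sym (∑-zero ys)
    ∑-swap (x ∷ xs) ys f =
      trans (cong (∑ ys (f x) +_) (∑-swap xs ys f)) (sym (∑-+ ys (f x) (λ y → ∑ xs (λ x → f x y))))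

    ∑-product : ∀ (xs : List A) (ys : List B) (f : A → ℕ) (g : B → ℕ) →
      ∑ xs f * ∑ ys g ≡ ∑ xs (λ x → ∑ ys (λ y → f x * g y))
    ∑-product xs ys f g =
      trans (sym (∑-*ʳ xs (∑ ys g) f)) (∑-cong xs (λ x → sym (∑-*ˡ ys (f x) g)))

  ∑Fin : ∀ n → (Fin n → ℕ) → ℕ
  ∑Fin n = ∑ (allFin n)

  ∑Fin-cong : ∀ n {f g : Fin n → ℕ} → (∀ x → f x ≡ g x) → ∑Fin n f ≡ ∑Fin n g
  ∑Fin-cong n = ∑-cong (allFin n)

  ∑-tabulate : ∀ {b} {B : Set b} n (g : Fin n → B) (f : B → ℕ) → ∑ (tabulate g) f ≡ ∑Fin n (f ∘ g)
  ∑-tabulate zero g f = refl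
  ∑-tabulate (suc n) g f =
    cong (f (g zero) +_) (trans (∑-tabulate n (g ∘ suc) f) (sym (∑-tabulate n suc (f ∘ g))))

  ∑Fin-suc : ∀ n (f : Fin (suc n) → ℕ) → ∑Fin (suc n) f ≡ f zero + ∑Fin n (f ∘ suc)
  ∑Fin-suc n f = cong (f zero +_) (∑-tabulate n suc f)

  ∑Fin-lookup : ∀ {b} {B : Set b} (xs : List B) (f : B → ℕ) → ∑Fin (length xs) (f ∘ lookup xs) ≡ ∑ xs f
  ∑Fin-lookup xs f = trans (sym (∑-tabulate (length xs) (lookup xs) f)) (cong (λ l → ∑ l f) (tabulate-lookup xs))

  ∑Fin-const : ∀ n c → ∑Fin n (λ _ → c) ≡ n * c
  ∑Fin-const zero c = refl
  ∑Fin-const (suc n) c = trans (∑Fin-suc n (λ _ → c)) (cong (c +_) (∑Fin-const n c))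

  ∑Fin-δ : ∀ n (u : Fin n) (f : Fin n → ℕ) → ∑Fin n (λ x → 𝟙 (u ≟F x) * f x) ≡ f u
  ∑Fin-δ (suc n) zero f = begin
    ∑Fin (suc n) (λ x → 𝟙 (zero ≟F x) * f x) ≡⟨ ∑Fin-suc n (λ x → 𝟙 (zero ≟F x) * f x) ⟩
    (f zero + 0) + ∑Fin n (λ x → 𝟙 (zero ≟F suc x) * f (suc x))
      ≡⟨ cong₂ _+_ (+-identityʳ (f zero)) (∑Fin-cong n (λ x → cong (_* f (suc x)) (𝟙-no (zero ≟F suc x) (λ ())))) ⟩
    f zero + ∑Fin n (λ _ → 0) ≡⟨ cong (f zero +_) (∑-zero (allFin n)) ⟩
    f zero + 0 ≡⟨ +-identityʳ (f zero) ⟩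
    f zero ∎
    where open ≡-Reasoning
  ∑Fin-δ (suc n) (suc u) f = begin
    ∑Fin (suc n) (λ x → 𝟙 (suc u ≟F x) * f x) ≡⟨ ∑Fin-suc n (λ x → 𝟙 (suc u ≟F x) * f x) ⟩
    𝟙 (suc u ≟F zero) * f zero + ∑Fin n (λ x → 𝟙 (suc u ≟F suc x) * f (suc x))
      ≡⟨ cong₂ _+_ (cong (_* f zero) (𝟙-no (suc u ≟F zero) (λ ())))
                   (∑Fin-cong n (λ x → cong (_* f (suc x)) (𝟙-iff (suc u ≟F suc x) (u ≟F x) FinP.suc-injective (cong suc)))) ⟩
    ∑Fin n (λ x → 𝟙 (u ≟F x) * f (suc x)) ≡⟨ ∑Fin-δ n u (f ∘ suc) ⟩
    f (suc u) ∎
    where open ≡-Reasoning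

  ∑Fin-δ' : ∀ n (u : Fin n) (f : Fin n → ℕ) → ∑Fin n (λ x → 𝟙 (x ≟F u) * f x) ≡ f u
  ∑Fin-δ' n u f = trans (∑Fin-cong n (λ x → cong (_* f x) (𝟙-iff (x ≟F u) (u ≟F x) sym sym))) (∑Fin-δ n u f)

  ∑Fin-δ₂ : ∀ n (u w : Fin n) (F : Fin n → Fin n → ℕ) →
    ∑Fin n (λ x → ∑Fin n (λ y → F x y * (𝟙 (x ≟F u) * 𝟙 (y ≟F w)))) ≡ F u w
  ∑Fin-δ₂ n u w F = begin
    ∑Fin n (λ x → ∑Fin n (λ y → F x y * (𝟙 (x ≟F u) * 𝟙 (y ≟F w))))
      ≡⟨ ∑Fin-cong n (λ x → trans (∑Fin-cong n (λ y → regroup (F x y) (𝟙 (x ≟F u)) (𝟙 (y ≟F w))))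
                                  (∑-*ˡ (allFin n) (𝟙 (x ≟F u)) (λ y → 𝟙 (y ≟F w) * F x y))) ⟩
    ∑Fin n (λ x → 𝟙 (x ≟F u) * ∑Fin n (λ y → 𝟙 (y ≟F w) * F x y)) ≡⟨ ∑Fin-δ' n u _ ⟩
    ∑Fin n (λ y → 𝟙 (y ≟F w) * F u y) ≡⟨ ∑Fin-δ' n w (F u) ⟩
    F u w ∎
    where
    open ≡-Reasoning
    regroup : ∀ a b c → a * (b * c) ≡ b * (c * a)
    regroup a b c = trans (*-comm a (b * c)) (*-assoc b c a)

  ∑Fin-involution : ∀ n (σ : Fin n → Fin n) → (∀ x → σ (σ x) ≡ x) → (f : Fin n → ℕ) →
    ∑Fin n (f ∘ σ) ≡ ∑Fin n f
  ∑Fin-involution n σ inv f = begin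
    ∑Fin n (f ∘ σ) ≡⟨ toMonoidSum n (f ∘ σ) ⟩
    MonoidSum.sum (f ∘ σ) ≡⟨ sym (MonoidSum.sum-permute f (Perm.permutation σ σ inv inv)) ⟩
    MonoidSum.sum f ≡⟨ sym (toMonoidSum n f) ⟩
    ∑Fin n f ∎
    where
    open ≡-Reasoning
    toMonoidSum : ∀ n (f : Fin n → ℕ) → ∑Fin n f ≡ MonoidSum.sum f
    toMonoidSum zero f = refl
    toMonoidSum (suc n) f = trans (∑Fin-suc n f) (cong (f zero +_) (toMonoidSum n (f ∘ suc)))

  ∑³ : ∀ n → (Fin n → Fin n → Fin n → ℕ) → ℕ
  ∑³ n f = ∑Fin n (λ i → ∑Fin n (λ j → ∑Fin n (f i j)))

  ∑³-cong : ∀ n {f g : Fin n → Fin n → Fin n → ℕ} → (∀ i j k → f i j k ≡ g i j k) → ∑³ n f ≡ ∑³ n g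
  ∑³-cong n h = ∑Fin-cong n (λ i → ∑Fin-cong n (λ j → ∑Fin-cong n (h i j)))

  ∑³-+ : ∀ n (f g : Fin n → Fin n → Fin n → ℕ) → ∑³ n (λ i j k → f i j k + g i j k) ≡ ∑³ n f + ∑³ n g
  ∑³-+ n f g =
    trans (∑Fin-cong n (λ i → trans (∑Fin-cong n (λ j → ∑-+ (allFin n) (f i j) (g i j)))
                                    (∑-+ (allFin n) (λ j → ∑Fin n (f i j)) (λ j → ∑Fin n (g i j)))))
          (∑-+ (allFin n) (λ i → ∑Fin n (λ j → ∑Fin n (f i j))) (λ i → ∑Fin n (λ j → ∑Fin n (g i j))))

  ∑³-*ˡ : ∀ n c (f : Fin n → Fin n → Fin n → ℕ) → ∑³ n (λ i j k → c * f i j k) ≡ c * ∑³ n f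
  ∑³-*ˡ n c f =
    trans (∑Fin-cong n (λ i → trans (∑Fin-cong n (λ j → ∑-*ˡ (allFin n) c (f i j)))
                                    (∑-*ˡ (allFin n) c (λ j → ∑Fin n (f i j)))))
          (∑-*ˡ (allFin n) c (λ i → ∑Fin n (λ j → ∑Fin n (f i j))))

  ∑³-swap₁₂ : ∀ n (f : Fin n → Fin n → Fin n → ℕ) → ∑³ n (λ i j k → f j i k) ≡ ∑³ n f
  ∑³-swap₁₂ n f = ∑-swap (allFin n) (allFin n) (λ i j → ∑Fin n (f j i))

  ∑³-swap₂₃ : ∀ n (f : Fin n → Fin n → Fin n → ℕ) → ∑³ n (λ i j k → f i k j) ≡ ∑³ n f
  ∑³-swap₂₃ n f = ∑Fin-cong n (λ i → ∑-swap (allFin n) (allFin n) (λ j k → f i k j))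

  ∑³-product : ∀ n (X Y Z : Fin n → ℕ) → ∑Fin n X * (∑Fin n Y * ∑Fin n Z) ≡ ∑³ n (λ u v w → X u * (Y v * Z w))
  ∑³-product n X Y Z = begin
    ∑Fin n X * (∑Fin n Y * ∑Fin n Z) ≡⟨ cong (∑Fin n X *_) (∑-product (allFin n) (allFin n) Y Z) ⟩
    ∑Fin n X * ∑Fin n (λ v → ∑Fin n (λ w → Y v * Z w)) ≡⟨ ∑-product (allFin n) (allFin n) X _ ⟩
    ∑Fin n (λ u → ∑Fin n (λ v → X u * ∑Fin n (λ w → Y v * Z w)))
      ≡⟨ ∑Fin-cong n (λ u → ∑Fin-cong n (λ v → sym (∑-*ˡ (allFin n) (X u) (λ w → Y v * Z w)))) ⟩
    ∑³ n (λ u v w → X u * (Y v * Z w)) ∎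
    where open ≡-Reasoning

  ∑-∑³-swap : ∀ {a} {A : Set a} (xs : List A) n (F : A → Fin n → Fin n → Fin n → ℕ) →
    ∑ xs (λ x → ∑³ n (F x)) ≡ ∑³ n (λ i j k → ∑ xs (λ x → F x i j k))
  ∑-∑³-swap xs n F =
    trans (∑-swap xs (allFin n) (λ x i → ∑Fin n (λ j → ∑Fin n (F x i j))))
          (∑Fin-cong n (λ i → trans (∑-swap xs (allFin n) (λ x j → ∑Fin n (F x i j)))
                                    (∑Fin-cong n (λ j → ∑-swap xs (allFin n) (λ x k → F x i j k)))))

  ∑³-∑³-swap : ∀ m n (H : Fin m → Fin m → Fin m → Fin n → Fin n → Fin n → ℕ) →
    ∑³ m (λ e f g → ∑³ n (H e f g)) ≡ ∑³ n (λ u v w → ∑³ m (λ e f g → H e f g u v w))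
  ∑³-∑³-swap m n H = begin
    ∑³ m (λ e f g → ∑³ n (H e f g))
      ≡⟨ ∑Fin-cong m (λ e → ∑Fin-cong m (λ f → ∑-∑³-swap (allFin m) n (H e f))) ⟩
    ∑Fin m (λ e → ∑Fin m (λ f → ∑³ n (λ u v w → ∑Fin m (λ g → H e f g u v w))))
      ≡⟨ ∑Fin-cong m (λ e → ∑-∑³-swap (allFin m) n (λ f u v w → ∑Fin m (λ g → H e f g u v w))) ⟩
    ∑Fin m (λ e → ∑³ n (λ u v w → ∑Fin m (λ f → ∑Fin m (λ g → H e f g u v w))))
      ≡⟨ ∑-∑³-swap (allFin m) n (λ e u v w → ∑Fin m (λ f → ∑Fin m (λ g → H e f g u v w))) ⟩
    ∑³ n (λ u v w → ∑³ m (λ e f g → H e f g u v w)) ∎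
    where open ≡-Reasoning

  ∑-pairs : ∀ n (h : Fin n × Fin n → ℕ) → ∑ (pairs n) h ≡ ∑Fin n (λ i → ∑Fin n (λ j → h (i , j)))
  ∑-pairs n h = trans (∑-concatMap (λ i → map (i ,_) (allFin n)) (allFin n) h)
                      (∑Fin-cong n (λ i → ∑-map (i ,_) (allFin n) h))

  ∑-triples : ∀ n (h : Fin n × Fin n × Fin n → ℕ) → ∑ (triples n) h ≡ ∑³ n (λ i j k → h (i , j , k))
  ∑-triples n h =
    trans (∑-concatMap (λ i → map (i ,_) (pairs n)) (allFin n) h)
          (∑Fin-cong n (λ i → trans (∑-map (i ,_) (pairs n) h) (∑-pairs n (λ jk → h (i , jk)))))

-- Triangles versus ordered triangles: in a graph without loops, each
-- triangle {i<j<k} is counted six times among the ordered triples (i,j,k)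
-- of pairwise adjacent vertices.

module OrderedTriangles where
  open import Data.Nat using (_+_; _*_)
  open import Data.Nat.Tactic.RingSolver using (solve-∀)
  open import Relation.Binary.Definitions using (tri<; tri≈; tri>)
  open Indicators
  open Sums
  open FinGraph

  lt : ∀ {n} → Fin n → Fin n → ℕ
  lt i j = 𝟙 (i F.<? j)

  lt-distinct : ∀ {n} {i j : Fin n} → i ≢ j → (lt i j ≡ 1 × lt j i ≡ 0) ⊎ (lt i j ≡ 0 × lt j i ≡ 1)
  lt-distinct {i = i} {j} i≢j with FinP.<-cmp i j
  ... | tri< i<j _ j≮i = inj₁ (𝟙-yes (i F.<? j) i<j , 𝟙-no (j F.<? i) j≮i)
  ... | tri≈ _ i≡j _ = ⊥-elim (i≢j i≡j)
  ... | tri> i≮j _ j<i = inj₂ (𝟙-no (i F.<? j) i≮j , 𝟙-yes (j F.<? i) j<i)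

  orderings : ∀ {n} → Fin n → Fin n → Fin n → ℕ
  orderings i j k =
    lt i j * lt j k + lt i k * lt k j + lt j i * lt i k + lt j k * lt k i + lt k i * lt i j + lt k j * lt j i

  orderings-distinct : ∀ {n} {i j k : Fin n} → i ≢ j → j ≢ k → i ≢ k → orderings i j k ≡ 1
  orderings-distinct {i = i} {j} {k} ij jk ik with lt-distinct ij | lt-distinct jk | lt-distinct ik
  ... | inj₁ (e1 , e2) | inj₁ (e3 , e4) | inj₁ (e5 , e6) rewrite e1 | e2 | e3 | e4 | e5 | e6 = refl
  ... | inj₁ (e1 , _) | inj₁ (e3 , _) | inj₂ (e5 , _) =
    ⊥-elim (𝟙≡0⇒ (i F.<? k) e5 (FinP.<-trans (𝟙≡1⇒ (i F.<? j) e1) (𝟙≡1⇒ (j F.<? k) e3)))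
  ... | inj₁ (e1 , e2) | inj₂ (e3 , e4) | inj₁ (e5 , e6) rewrite e1 | e2 | e3 | e4 | e5 | e6 = refl
  ... | inj₁ (e1 , e2) | inj₂ (e3 , e4) | inj₂ (e5 , e6) rewrite e1 | e2 | e3 | e4 | e5 | e6 = refl
  ... | inj₂ (e1 , e2) | inj₁ (e3 , e4) | inj₁ (e5 , e6) rewrite e1 | e2 | e3 | e4 | e5 | e6 = refl
  ... | inj₂ (e1 , e2) | inj₁ (e3 , e4) | inj₂ (e5 , e6) rewrite e1 | e2 | e3 | e4 | e5 | e6 = refl
  ... | inj₂ (_ , e2) | inj₂ (_ , e4) | inj₁ (_ , e6) =
    ⊥-elim (𝟙≡0⇒ (k F.<? i) e6 (FinP.<-trans (𝟙≡1⇒ (k F.<? j) e4) (𝟙≡1⇒ (j F.<? i) e2)))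
  ... | inj₂ (e1 , e2) | inj₂ (e3 , e4) | inj₂ (e5 , e6) rewrite e1 | e2 | e3 | e4 | e5 | e6 = refl

  symmetrize : ∀ {n} → (Fin n → Fin n → Fin n → ℕ) → Fin n → Fin n → Fin n → ℕ
  symmetrize f i j k = f i j k + f i k j + f j i k + f j k i + f k i j + f k j i

  ∑³-symmetrize : ∀ n (f : Fin n → Fin n → Fin n → ℕ) → ∑³ n (symmetrize f) ≡ 6 * ∑³ n f
  ∑³-symmetrize n f = trans (add (add (add (add (add refl e₂) e₃) e₄) e₅) e₆) (six (∑³ n f))
    where
    add : ∀ {h g A} → ∑³ n h ≡ A → ∑³ n g ≡ ∑³ n f → ∑³ n (λ i j k → h i j k + g i j k) ≡ A + ∑³ n f
    add p q = trans (∑³-+ n _ _) (cong₂ _+_ p q)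
    six : ∀ x → x + x + x + x + x + x ≡ 6 * x
    six = solve-∀
    e₂ : ∑³ n (λ i j k → f i k j) ≡ ∑³ n f
    e₂ = ∑³-swap₂₃ n f
    e₃ : ∑³ n (λ i j k → f j i k) ≡ ∑³ n f
    e₃ = ∑³-swap₁₂ n f
    e₄ : ∑³ n (λ i j k → f j k i) ≡ ∑³ n f
    e₄ = trans (sym (∑³-swap₁₂ n (λ i j k → f j k i))) e₂
    e₅ : ∑³ n (λ i j k → f k i j) ≡ ∑³ n f
    e₅ = trans (sym (∑³-swap₂₃ n (λ i j k → f k i j))) e₃
    e₆ : ∑³ n (λ i j k → f k j i) ≡ ∑³ n f
    e₆ = trans (sym (∑³-swap₂₃ n (λ i j k → f k j i))) e₄

  module _ {n} (W : Fin n → Fin n → Fin n → ℕ)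
           (W₁₂ : ∀ i j k → W j i k ≡ W i j k) (W₂₃ : ∀ i j k → W i k j ≡ W i j k) where

    increasing : Fin n → Fin n → Fin n → ℕ
    increasing i j k = (lt i j * lt j k) * W i j k

    symmetrize-increasing : ∀ i j k → symmetrize increasing i j k ≡ orderings i j k * W i j k
    symmetrize-increasing i j k =
      trans (cong₂ _+_ (cong₂ _+_ (cong₂ _+_ (cong₂ _+_ (cong₂ _+_ refl
              (cong (lt i k * lt k j *_) (W₂₃ i j k))) (cong (lt j i * lt i k *_) (W₁₂ i j k)))
              (cong (lt j k * lt k i *_) Wjki)) (cong (lt k i * lt i j *_) Wkij)) (cong (lt k j * lt j i *_) Wkji))
            (dist (W i j k) (lt i j * lt j k) (lt i k * lt k j) (lt j i * lt i k)
                  (lt j k * lt k i) (lt k i * lt i j) (lt k j * lt j i))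
      where
      Wkij : W k i j ≡ W i j k
      Wkij = trans (W₁₂ i k j) (W₂₃ i j k)
      Wkji : W k j i ≡ W i j k
      Wkji = trans (W₂₃ k i j) Wkij
      Wjki : W j k i ≡ W i j k
      Wjki = trans (W₁₂ k j i) Wkji
      dist : ∀ w t₁ t₂ t₃ t₄ t₅ t₆ →
        t₁ * w + t₂ * w + t₃ * w + t₄ * w + t₅ * w + t₆ * w ≡ (t₁ + t₂ + t₃ + t₄ + t₅ + t₆) * w
      dist = solve-∀

  adj : (G : FinGraph) → Fin (V G) → Fin (V G) → ℕ
  adj G i j = 𝟙 (adj? G i j)

  Δ : (G : FinGraph) → Fin (V G) → Fin (V G) → Fin (V G) → ℕ
  Δ G i j k = adj G i j * (adj G j k * adj G i k)

  n3-as-sum : (G : FinGraph) → n3 G ≡ ∑³ (V G) (λ i j k → (lt i j * lt j k) * Δ G i j k)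
  n3-as-sum G =
    trans (length-filter-∑ _ (triples (V G)))
    (trans (∑-triples (V G) _)
    (∑³-cong (V G) (λ i j k →
      trans (𝟙-× ((i F.<? j) ×-dec (j F.<? k)) (adj? G i j ×-dec (adj? G j k ×-dec adj? G i k)))
            (cong₂ _*_ (𝟙-× (i F.<? j) (j F.<? k))
                       (trans (𝟙-× (adj? G i j) (adj? G j k ×-dec adj? G i k))
                              (cong (adj G i j *_) (𝟙-× (adj? G j k) (adj? G i k))))))))

  six-n3 : (G : FinGraph) → (∀ {i j} → Adj G i j → Adj G j i) → (∀ {i} → ¬ Adj G i i) →
    6 * n3 G ≡ ∑³ (V G) (Δ G)
  six-n3 G adj-sym adj-irr = begin
    6 * n3 G ≡⟨ cong (6 *_) (n3-as-sum G) ⟩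
    6 * ∑³ (V G) (increasing (Δ G) Δ₁₂ Δ₂₃) ≡⟨ sym (∑³-symmetrize (V G) _) ⟩
    ∑³ (V G) (symmetrize (increasing (Δ G) Δ₁₂ Δ₂₃)) ≡⟨ ∑³-cong (V G) (symmetrize-increasing (Δ G) Δ₁₂ Δ₂₃) ⟩
    ∑³ (V G) (λ i j k → orderings i j k * Δ G i j k) ≡⟨ ∑³-cong (V G) orderings-of-triangle ⟩
    ∑³ (V G) (Δ G) ∎
    where
    open ≡-Reasoning
    adj-comm : ∀ i j → adj G i j ≡ adj G j i
    adj-comm i j = 𝟙-iff (adj? G i j) (adj? G j i) adj-sym adj-sym
    Δ₁₂ : ∀ i j k → Δ G j i k ≡ Δ G i j k
    Δ₁₂ i j k rewrite adj-comm j i = lemma (adj G i j) (adj G i k) (adj G j k)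
      where lemma : ∀ x y z → x * (y * z) ≡ x * (z * y)
            lemma = solve-∀
    Δ₂₃ : ∀ i j k → Δ G i k j ≡ Δ G i j k
    Δ₂₃ i j k rewrite adj-comm k j = lemma (adj G i k) (adj G j k) (adj G i j)
      where lemma : ∀ x y z → x * (y * z) ≡ z * (y * x)
            lemma = solve-∀
    distinct : ∀ {i j} → adj G i j ≡ 1 → i ≢ j
    distinct {i} e refl = adj-irr (𝟙≡1⇒ (adj? G i i) e)
    orderings-of-triangle : ∀ i j k → orderings i j k * Δ G i j k ≡ Δ G i j k
    orderings-of-triangle i j k =
      bit-absorb (orderings i j k) (bit-* (bit-𝟙 (adj? G i j)) (bit-* (bit-𝟙 (adj? G j k)) (bit-𝟙 (adj? G i k))))
        (λ e → let (ij , jk-ik) = *≡1 (adj G i j) _ e ; (jk , ik) = *≡1 (adj G j k) _ jk-ik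
               in orderings-distinct (distinct ij) (distinct jk) (distinct ik))

module DistinctTriples where
  open import Data.Nat using (_+_; _*_; _∸_)
  open import Data.Nat.Properties using (+-assoc; *-identityˡ; *-distribʳ-+; m+n∸n≡m)
  open import Data.Nat.Tactic.RingSolver using (solve-∀)
  open Indicators
  open Sums

  ≢𝟙 : ∀ {m} → Fin m → Fin m → ℕ
  ≢𝟙 e f = 𝟙 (¬? (e ≟F f))

  ≢𝟙-bit : ∀ {m} (e f : Fin m) → Bit (≢𝟙 e f)
  ≢𝟙-bit e f = bit-𝟙 (¬? (e ≟F f))

  ≢𝟙≡1⇒ : ∀ {m} {e f : Fin m} → ≢𝟙 e f ≡ 1 → e ≢ f
  ≢𝟙≡1⇒ {e = e} {f} = 𝟙≡1⇒ (¬? (e ≟F f))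

  distinct : ∀ {m} → Fin m → Fin m → Fin m → ℕ
  distinct e f g = ≢𝟙 e f * (≢𝟙 f g * ≢𝟙 e g)

  distinct-bit : ∀ {m} (e f g : Fin m) → Bit (distinct e f g)
  distinct-bit e f g = bit-* (≢𝟙-bit e f) (bit-* (≢𝟙-bit f g) (≢𝟙-bit e g))

  distinct-≢ : ∀ {m} {e f g : Fin m} → distinct e f g ≡ 1 → e ≢ f × f ≢ g × e ≢ g
  distinct-≢ {e = e} {f} {g} h =
    let (ef , fg-eg) = *≡1 (≢𝟙 e f) _ h ; (fg , eg) = *≡1 (≢𝟙 f g) _ fg-eg
    in ≢𝟙≡1⇒ ef , ≢𝟙≡1⇒ fg , ≢𝟙≡1⇒ eg

  distinct-intro : ∀ {m} {e f g : Fin m} → e ≢ f → f ≢ g → e ≢ g → distinct e f g ≡ 1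
  distinct-intro {e = e} {f} {g} ef fg eg =
    cong₂ _*_ (𝟙-yes (¬? (e ≟F f)) ef) (cong₂ _*_ (𝟙-yes (¬? (f ≟F g)) fg) (𝟙-yes (¬? (e ≟F g)) eg))

  module _ (N : ℕ) (s : Fin N → ℕ) (s-bit : ∀ e → Bit (s e)) (k : ℕ) (∑s : ∑Fin N s ≡ k) where

    ∑-except-one : ∀ e → ∑Fin N (λ f → ≢𝟙 e f * s f) + s e ≡ k
    ∑-except-one e = begin
      ∑Fin N (λ f → ≢𝟙 e f * s f) + s e ≡⟨ cong (∑Fin N (λ f → ≢𝟙 e f * s f) +_) (sym (∑Fin-δ N e s)) ⟩
      ∑Fin N (λ f → ≢𝟙 e f * s f) + ∑Fin N (λ f → 𝟙 (e ≟F f) * s f) ≡⟨ sym (∑-+ (allFin N) _ _) ⟩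
      ∑Fin N (λ f → ≢𝟙 e f * s f + 𝟙 (e ≟F f) * s f) ≡⟨ ∑Fin-cong N split ⟩
      ∑Fin N s ≡⟨ ∑s ⟩
      k ∎
      where
      open ≡-Reasoning
      split : ∀ f → ≢𝟙 e f * s f + 𝟙 (e ≟F f) * s f ≡ s f
      split f = trans (sym (*-distribʳ-+ (s f) (≢𝟙 e f) _)) (trans (cong (_* s f) (𝟙-¬ (e ≟F f))) (*-identityˡ (s f)))

    ∑-except-two : ∀ {e f} → e ≢ f → ∑Fin N (λ g → (≢𝟙 f g * ≢𝟙 e g) * s g) + s e + s f ≡ k
    ∑-except-two {e} {f} e≢f = begin
      ∑Fin N (λ g → (≢𝟙 f g * ≢𝟙 e g) * s g) + s e + s f
        ≡⟨ cong₂ (λ x y → ∑Fin N (λ g → (≢𝟙 f g * ≢𝟙 e g) * s g) + x + y) (sym (∑Fin-δ N e s)) (sym (∑Fin-δ N f s)) ⟩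
      ∑Fin N (λ g → (≢𝟙 f g * ≢𝟙 e g) * s g) + ∑Fin N (λ g → 𝟙 (e ≟F g) * s g) + ∑Fin N (λ g → 𝟙 (f ≟F g) * s g)
        ≡⟨ cong (_+ ∑Fin N (λ g → 𝟙 (f ≟F g) * s g)) (sym (∑-+ (allFin N) _ _)) ⟩
      ∑Fin N (λ g → (≢𝟙 f g * ≢𝟙 e g) * s g + 𝟙 (e ≟F g) * s g) + ∑Fin N (λ g → 𝟙 (f ≟F g) * s g)
        ≡⟨ sym (∑-+ (allFin N) _ _) ⟩
      ∑Fin N (λ g → (≢𝟙 f g * ≢𝟙 e g) * s g + 𝟙 (e ≟F g) * s g + 𝟙 (f ≟F g) * s g)
        ≡⟨ ∑Fin-cong N (λ g → trans (factor (≢𝟙 f g * ≢𝟙 e g) (𝟙 (e ≟F g)) (𝟙 (f ≟F g)) (s g)) (trans (cong (_* s g) (partition g)) (*-identityˡ (s g)))) ⟩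
      ∑Fin N s ≡⟨ ∑s ⟩
      k ∎
      where
      open ≡-Reasoning
      factor : ∀ x y z w → x * w + y * w + z * w ≡ (x + y + z) * w
      factor = solve-∀
      partition : ∀ g → ≢𝟙 f g * ≢𝟙 e g + 𝟙 (e ≟F g) + 𝟙 (f ≟F g) ≡ 1
      partition g with f ≟F g | e ≟F g
      ... | yes f≡g | yes e≡g = ⊥-elim (e≢f (trans e≡g (sym f≡g)))
      ... | yes _ | no _ = refl
      ... | no _ | yes _ = refl
      ... | no _ | no _ = refl

    ∑-distinct-triples : ∑³ N (λ e f g → distinct e f g * (s e * (s f * s g))) ≡ k * ((k ∸ 1) * (k ∸ 2))
    ∑-distinct-triples = begin
      ∑³ N (λ e f g → distinct e f g * (s e * (s f * s g)))
        ≡⟨ ∑Fin-cong N (λ e → ∑Fin-cong N (λ f → trans (∑Fin-cong N (λ g → regroup₁ (≢𝟙 e f) (≢𝟙 f g) (≢𝟙 e g) (s e) (s f) (s g)))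
                                                        (∑-*ˡ (allFin N) (≢𝟙 e f * (s e * s f)) (third e f)))) ⟩
      ∑Fin N (λ e → ∑Fin N (λ f → (≢𝟙 e f * (s e * s f)) * ∑Fin N (third e f)))
        ≡⟨ ∑Fin-cong N (λ e → ∑Fin-cong N (λ f → bit-*-cong (∑Fin N (third e f)) (k ∸ 2) (bit-* (≢𝟙-bit e f) (bit-* (s-bit e) (s-bit f))) (count-third e f))) ⟩
      ∑Fin N (λ e → ∑Fin N (λ f → (≢𝟙 e f * (s e * s f)) * (k ∸ 2)))
        ≡⟨ ∑Fin-cong N (λ e → trans (∑Fin-cong N (λ f → regroup₂ (≢𝟙 e f) (s e) (s f) (k ∸ 2)))
                                    (trans (∑-*ˡ (allFin N) (s e) (λ f → (≢𝟙 e f * s f) * (k ∸ 2)))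
                                           (cong (s e *_) (∑-*ʳ (allFin N) (k ∸ 2) (λ f → ≢𝟙 e f * s f))))) ⟩
      ∑Fin N (λ e → s e * (∑Fin N (λ f → ≢𝟙 e f * s f) * (k ∸ 2)))
        ≡⟨ ∑Fin-cong N (λ e → bit-*-cong (∑Fin N (λ f → ≢𝟙 e f * s f) * (k ∸ 2)) ((k ∸ 1) * (k ∸ 2)) (s-bit e) (λ h → cong (_* (k ∸ 2)) (count-second e h))) ⟩
      ∑Fin N (λ e → s e * ((k ∸ 1) * (k ∸ 2))) ≡⟨ ∑-*ʳ (allFin N) ((k ∸ 1) * (k ∸ 2)) s ⟩
      ∑Fin N s * ((k ∸ 1) * (k ∸ 2)) ≡⟨ cong (_* ((k ∸ 1) * (k ∸ 2))) ∑s ⟩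
      k * ((k ∸ 1) * (k ∸ 2)) ∎
      where
      open ≡-Reasoning
      third : Fin N → Fin N → Fin N → ℕ
      third e f g = (≢𝟙 f g * ≢𝟙 e g) * s g
      regroup₁ : ∀ a b c x y z → (a * (b * c)) * (x * (y * z)) ≡ (a * (x * y)) * ((b * c) * z)
      regroup₁ = solve-∀
      regroup₂ : ∀ a x y c → (a * (x * y)) * c ≡ x * ((a * y) * c)
      regroup₂ = solve-∀
      count-third : ∀ e f → ≢𝟙 e f * (s e * s f) ≡ 1 → ∑Fin N (third e f) ≡ k ∸ 2
      count-third e f h with *≡1 (≢𝟙 e f) _ h
      ... | (e≢f , se-sf) with *≡1 (s e) (s f) se-sf
      ... | (se , sf) = begin
        ∑Fin N (third e f) ≡⟨ sym (m+n∸n≡m _ 2) ⟩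
        ∑Fin N (third e f) + 2 ∸ 2 ≡⟨ cong (λ x → ∑Fin N (third e f) + x ∸ 2) (sym (cong₂ _+_ se sf)) ⟩
        ∑Fin N (third e f) + (s e + s f) ∸ 2 ≡⟨ cong (_∸ 2) (sym (+-assoc (∑Fin N (third e f)) (s e) (s f))) ⟩
        ∑Fin N (third e f) + s e + s f ∸ 2 ≡⟨ cong (_∸ 2) (∑-except-two (≢𝟙≡1⇒ e≢f)) ⟩
        k ∸ 2 ∎
      count-second : ∀ e → s e ≡ 1 → ∑Fin N (λ f → ≢𝟙 e f * s f) ≡ k ∸ 1
      count-second e h = begin
        ∑Fin N (λ f → ≢𝟙 e f * s f) ≡⟨ sym (m+n∸n≡m _ 1) ⟩
        ∑Fin N (λ f → ≢𝟙 e f * s f) + 1 ∸ 1 ≡⟨ cong (λ x → ∑Fin N (λ f → ≢𝟙 e f * s f) + x ∸ 1) (sym h) ⟩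
        ∑Fin N (λ f → ≢𝟙 e f * s f) + s e ∸ 1 ≡⟨ cong (_∸ 1) (∑-except-one e) ⟩
        k ∸ 1 ∎

-- Incidence between vertices and edges given by their two endpoints

module PairIncidence where
  open import Data.Nat using (_+_; _*_)
  open Indicators

  _∈ₑ_ : ∀ {n} → Fin n → Fin n × Fin n → Set
  u ∈ₑ (x , y) = x ≡ u ⊎ y ≡ u

  _∈ₑ?_ : ∀ {n} (u : Fin n) (r : Fin n × Fin n) → Dec (u ∈ₑ r)
  u ∈ₑ? (x , y) = (x ≟F u) ⊎-dec (y ≟F u)

  ι : ∀ {n} → Fin n → Fin n × Fin n → ℕ
  ι u r = 𝟙 (u ∈ₑ? r)

  ι-split : ∀ {n} (u x y : Fin n) → x ≢ y → ι u (x , y) ≡ 𝟙 (x ≟F u) + 𝟙 (y ≟F u)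
  ι-split u x y x≢y with x ≟F u | y ≟F u
  ... | yes p | yes q = ⊥-elim (x≢y (trans p (sym q)))
  ... | yes _ | no _ = refl
  ... | no _ | yes _ = refl
  ... | no _ | no _ = refl

  ι-two : ∀ {n} (u w x y : Fin n) → x ≢ y → u ≢ w →
    ι u (x , y) * ι w (x , y) ≡ 𝟙 (x ≟F u) * 𝟙 (y ≟F w) + 𝟙 (x ≟F w) * 𝟙 (y ≟F u)
  ι-two u w x y x≢y u≢w rewrite ι-split u x y x≢y | ι-split w x y x≢y
    with x ≟F u | y ≟F u | x ≟F w | y ≟F w
  ... | yes p | yes q | _ | _ = ⊥-elim (x≢y (trans p (sym q)))
  ... | yes p | no _ | yes r | _ = ⊥-elim (u≢w (trans (sym p) r))
  ... | yes _ | no _ | no _ | yes _ = refl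
  ... | yes _ | no _ | no _ | no _ = refl
  ... | no _ | yes _ | yes r | yes s = ⊥-elim (x≢y (trans r (sym s)))
  ... | no _ | yes _ | yes _ | no _ = refl
  ... | no _ | yes q | no _ | yes s = ⊥-elim (u≢w (trans (sym q) s))
  ... | no _ | yes _ | no _ | no _ = refl
  ... | no _ | no _ | yes r | yes s = ⊥-elim (x≢y (trans r (sym s)))
  ... | no _ | no _ | yes _ | no _ = refl
  ... | no _ | no _ | no _ | yes _ = refl
  ... | no _ | no _ | no _ | no _ = refl

  no-three-ends : ∀ {n} {u v w : Fin n} r → u ≢ v → v ≢ w → u ≢ w → u ∈ₑ r → v ∈ₑ r → w ∈ₑ r → ⊥
  no-three-ends r uv vw uw (inj₁ a) (inj₁ b) _ = uv (trans (sym a) b)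
  no-three-ends r uv vw uw (inj₂ a) (inj₂ b) _ = uv (trans (sym a) b)
  no-three-ends r uv vw uw (inj₁ a) (inj₂ b) (inj₁ c) = uw (trans (sym a) c)
  no-three-ends r uv vw uw (inj₁ a) (inj₂ b) (inj₂ c) = vw (trans (sym b) c)
  no-three-ends r uv vw uw (inj₂ a) (inj₁ b) (inj₁ c) = vw (trans (sym b) c)
  no-three-ends r uv vw uw (inj₂ a) (inj₁ b) (inj₂ c) = uw (trans (sym a) c)

  two-ends : ∀ {n} {u w x y : Fin n} → u ≢ w → u ∈ₑ (x , y) → w ∈ₑ (x , y) →
    (x ≡ u × y ≡ w) ⊎ (x ≡ w × y ≡ u)
  two-ends uw (inj₁ a) (inj₁ b) = ⊥-elim (uw (trans (sym a) b))
  two-ends uw (inj₁ a) (inj₂ b) = inj₁ (a , b)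
  two-ends uw (inj₂ a) (inj₁ b) = inj₂ (b , a)
  two-ends uw (inj₂ a) (inj₂ b) = ⊥-elim (uw (trans (sym a) b))

-- Three pairwise adjacent edges either pass through one common vertex
-- (a star, k(k-1)(k-2) ordered choices at each vertex) or form a triangle
-- of G. Adjacency in L(G) is expressed through the vertex/edge incidence ι,
-- which turns the ordered-triangle count of L(G) into a sum over ordered
-- triples of edges (e,f,g) and of vertices (u,v,w) with u ∈ e∩f, v ∈ f∩g,
-- w ∈ e∩g.

module LineGraphTriangles (G : FinGraph)
    (adj-sym : ∀ {i j} → FinGraph.Adj G i j → FinGraph.Adj G j i)
    (adj-irr : ∀ {i} → ¬ FinGraph.Adj G i i)
    (k : ℕ) (regular : ∀ u → Sums.∑Fin (FinGraph.V G) (OrderedTriangles.adj G u) ≡ k) where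
  open import Data.Nat using (_+_; _*_; _∸_)
  open import Data.Nat.Properties using (*-comm; *-identityʳ; *-distribˡ-+; *-distribʳ-+)
  open import Data.Nat.Tactic.RingSolver using (solve-∀)
  open import Data.List.Membership.Propositional.Properties using (∈-lookup)
  import Data.List.Relation.Unary.All as All
  open import Data.List.Relation.Unary.All.Properties using (all-filter)
  open import Data.List.Relation.Unary.AllPairs using (_∷_)
  open import Data.List.Relation.Unary.Unique.Propositional using (Unique)
  open import Data.List.Relation.Unary.Unique.Propositional.Properties using (cartesianProduct⁺; allFin⁺; filter⁺)
  open Indicators
  open Sums
  open OrderedTriangles using (lt; lt-distinct; adj; Δ; six-n3)
  open DistinctTriples
  open PairIncidence
  open FinGraph G

  n : ℕ
  n = V

  N : ℕ
  N = length (edges G)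

  ends : Fin N → Fin n × Fin n
  ends e = lookup (edges G) e

  ends-edge : ∀ e → IsEdge G (ends e)
  ends-edge e = All.lookup (all-filter _ (pairs n)) (∈-lookup e)

  ends-distinct : ∀ e → proj₁ (ends e) ≢ proj₂ (ends e)
  ends-distinct e eq = FinP.<-irrefl eq (proj₁ (ends-edge e))

  -- no edge is listed twice, since pairs n enumerates Fin n × Fin n without repetition
  ends-injective : ∀ {e f} → ends e ≡ ends f → e ≡ f
  ends-injective = unique-lookup (filter⁺ _ (subst Unique (sym (pairs-cartesian (allFin n)))
                                                  (cartesianProduct⁺ (allFin⁺ n) (allFin⁺ n)))) _ _
    where
    pairs-cartesian : (xs : List (Fin n)) → concatMap (λ i → map (i ,_) (allFin n)) xs ≡ cartesianProduct xs (allFin n)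
    pairs-cartesian [] = refl
    pairs-cartesian (x ∷ xs) = cong (map (x ,_) (allFin n) ++_) (pairs-cartesian xs)
    unique-lookup : ∀ {A : Set} {xs : List A} → Unique xs → ∀ i j → lookup xs i ≡ lookup xs j → i ≡ j
    unique-lookup (_ ∷ _) zero zero _ = refl
    unique-lookup (x∉ ∷ _) zero (suc j) eq = ⊥-elim (All.lookup x∉ (∈-lookup j) eq)
    unique-lookup (x∉ ∷ _) (suc i) zero eq = ⊥-elim (All.lookup x∉ (∈-lookup i) (sym eq))
    unique-lookup (_ ∷ u) (suc i) (suc j) eq = cong suc (unique-lookup u i j eq)

  edge𝟙 : Fin n → Fin n → ℕ
  edge𝟙 x y = lt x y * adj G x y

  edge𝟙-bit : ∀ x y → Bit (edge𝟙 x y)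
  edge𝟙-bit x y = bit-* (bit-𝟙 (x F.<? y)) (bit-𝟙 (adj? x y))

  edge𝟙-distinct : ∀ {x y} → edge𝟙 x y ≡ 1 → x ≢ y
  edge𝟙-distinct {x} {y} e eq = FinP.<-irrefl eq (𝟙≡1⇒ (x F.<? y) (proj₁ (*≡1 (lt x y) (adj G x y) e)))

  edge𝟙-both : ∀ u w → edge𝟙 u w + edge𝟙 w u ≡ adj G u w
  edge𝟙-both u w with adj? u w
  ... | no ¬uw rewrite 𝟙-no (adj? w u) (λ wu → ¬uw (adj-sym wu)) = cong₂ _+_ (*-comm (lt u w) 0) (*-comm (lt w u) 0)
  ... | yes uw with lt-distinct {i = u} {w} (λ { refl → adj-irr uw })
  ...   | inj₁ (e₁ , e₂) rewrite e₁ | e₂ = refl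
  ...   | inj₂ (e₁ , e₂) rewrite e₁ | e₂ | 𝟙-yes (adj? w u) (adj-sym uw) = refl

  ∑-edges : ∀ (h : Fin n × Fin n → ℕ) → ∑Fin N (h ∘ ends) ≡ ∑Fin n (λ x → ∑Fin n (λ y → edge𝟙 x y * h (x , y)))
  ∑-edges h = trans (∑Fin-lookup (edges G) h) (trans (∑-filter _ (pairs n) h) (trans (∑-pairs n _)
                (∑Fin-cong n (λ x → ∑Fin-cong n (λ y → cong (_* h (x , y)) (𝟙-× (x F.<? y) (adj? x y)))))))

  I : Fin n → Fin N → ℕ
  I u e = ι u (ends e)

  I-bit : ∀ u e → Bit (I u e)
  I-bit u e = bit-𝟙 (u ∈ₑ? ends e)

  ∑² : (Fin n → Fin n → ℕ) → ℕ
  ∑² F = ∑Fin n (λ x → ∑Fin n (F x))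

  ∑²-+ : ∀ (F H : Fin n → Fin n → ℕ) → ∑² (λ x y → F x y + H x y) ≡ ∑² F + ∑² H
  ∑²-+ F H = trans (∑Fin-cong n (λ x → ∑-+ (allFin n) (F x) (H x))) (∑-+ (allFin n) _ _)

  degree-by-edges : ∀ u → ∑Fin N (I u) ≡ k
  degree-by-edges u = begin
    ∑Fin N (I u) ≡⟨ ∑-edges (ι u) ⟩
    ∑² (λ x y → edge𝟙 x y * ι u (x , y)) ≡⟨ ∑Fin-cong n (λ x → ∑Fin-cong n (λ y → by-endpoint x y)) ⟩
    ∑² (λ x y → 𝟙 (x ≟F u) * edge𝟙 x y + 𝟙 (y ≟F u) * edge𝟙 x y) ≡⟨ ∑²-+ _ _ ⟩
    ∑² (λ x y → 𝟙 (x ≟F u) * edge𝟙 x y) + ∑² (λ x y → 𝟙 (y ≟F u) * edge𝟙 x y)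
      ≡⟨ cong₂ _+_ (trans (∑Fin-cong n (λ x → ∑-*ˡ (allFin n) (𝟙 (x ≟F u)) (edge𝟙 x)))
                          (∑Fin-δ' n u (λ x → ∑Fin n (edge𝟙 x))))
                   (∑Fin-cong n (λ x → ∑Fin-δ' n u (edge𝟙 x))) ⟩
    ∑Fin n (edge𝟙 u) + ∑Fin n (λ z → edge𝟙 z u) ≡⟨ sym (∑-+ (allFin n) (edge𝟙 u) (λ z → edge𝟙 z u)) ⟩
    ∑Fin n (λ z → edge𝟙 u z + edge𝟙 z u) ≡⟨ ∑Fin-cong n (edge𝟙-both u) ⟩
    ∑Fin n (adj G u) ≡⟨ regular u ⟩
    k ∎
    where
    open ≡-Reasoning
    by-endpoint : ∀ x y → edge𝟙 x y * ι u (x , y) ≡ 𝟙 (x ≟F u) * edge𝟙 x y + 𝟙 (y ≟F u) * edge𝟙 x y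
    by-endpoint x y =
      trans (bit-*-cong (ι u (x , y)) _ (edge𝟙-bit x y) (λ e → ι-split u x y (edge𝟙-distinct e)))
            (trans (*-comm (edge𝟙 x y) _) (*-distribʳ-+ (edge𝟙 x y) (𝟙 (x ≟F u)) (𝟙 (y ≟F u))))

  codegree : ∀ {u w} → u ≢ w → ∑Fin N (λ e → I u e * I w e) ≡ adj G u w
  codegree {u} {w} u≢w = begin
    ∑Fin N (λ e → I u e * I w e) ≡⟨ ∑-edges (λ r → ι u r * ι w r) ⟩
    ∑² (λ x y → edge𝟙 x y * (ι u (x , y) * ι w (x , y))) ≡⟨ ∑Fin-cong n (λ x → ∑Fin-cong n (λ y → by-orientation x y)) ⟩
    ∑² (λ x y → edge𝟙 x y * (𝟙 (x ≟F u) * 𝟙 (y ≟F w)) + edge𝟙 x y * (𝟙 (x ≟F w) * 𝟙 (y ≟F u))) ≡⟨ ∑²-+ _ _ ⟩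
    ∑² (λ x y → edge𝟙 x y * (𝟙 (x ≟F u) * 𝟙 (y ≟F w))) + ∑² (λ x y → edge𝟙 x y * (𝟙 (x ≟F w) * 𝟙 (y ≟F u)))
      ≡⟨ cong₂ _+_ (∑Fin-δ₂ n u w edge𝟙) (∑Fin-δ₂ n w u edge𝟙) ⟩
    edge𝟙 u w + edge𝟙 w u ≡⟨ edge𝟙-both u w ⟩
    adj G u w ∎
    where
    open ≡-Reasoning
    by-orientation : ∀ x y → edge𝟙 x y * (ι u (x , y) * ι w (x , y))
                           ≡ edge𝟙 x y * (𝟙 (x ≟F u) * 𝟙 (y ≟F w)) + edge𝟙 x y * (𝟙 (x ≟F w) * 𝟙 (y ≟F u))
    by-orientation x y =
      trans (bit-*-cong (ι u (x , y) * ι w (x , y)) _ (edge𝟙-bit x y) (λ e → ι-two u w x y (edge𝟙-distinct e) u≢w))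
            (*-distribˡ-+ (edge𝟙 x y) _ _)

  share-end : ∀ {e f} → e ≢ f → 𝟙 (shareEnd? (ends e) (ends f)) ≡ ∑Fin n (λ u → I u e * I u f)
  share-end {e} {f} e≢f = sym (begin
    ∑Fin n (λ u → I u e * I u f)
      ≡⟨ ∑Fin-cong n (λ u → trans (cong₂ _*_ (ι-split u x₁ y₁ (ends-distinct e)) (ι-split u x₂ y₂ (ends-distinct f)))
                                  (expand (𝟙 (x₁ ≟F u)) (𝟙 (y₁ ≟F u)) (𝟙 (x₂ ≟F u)) (𝟙 (y₂ ≟F u)))) ⟩
    ∑Fin n (λ u → (𝟙 (x₁ ≟F u) * 𝟙 (x₂ ≟F u) + 𝟙 (x₁ ≟F u) * 𝟙 (y₂ ≟F u))
                + (𝟙 (y₁ ≟F u) * 𝟙 (x₂ ≟F u) + 𝟙 (y₁ ≟F u) * 𝟙 (y₂ ≟F u)))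
      ≡⟨ trans (∑-+ (allFin n) _ _) (cong₂ _+_ (∑-+ (allFin n) _ _) (∑-+ (allFin n) _ _)) ⟩
    (∑Fin n (λ u → 𝟙 (x₁ ≟F u) * 𝟙 (x₂ ≟F u)) + ∑Fin n (λ u → 𝟙 (x₁ ≟F u) * 𝟙 (y₂ ≟F u)))
      + (∑Fin n (λ u → 𝟙 (y₁ ≟F u) * 𝟙 (x₂ ≟F u)) + ∑Fin n (λ u → 𝟙 (y₁ ≟F u) * 𝟙 (y₂ ≟F u)))
      ≡⟨ cong₂ _+_ (cong₂ _+_ (meet x₁ x₂) (meet x₁ y₂)) (cong₂ _+_ (meet y₁ x₂) (meet y₁ y₂)) ⟩
    (𝟙 (x₁ ≟F x₂) + 𝟙 (x₁ ≟F y₂)) + (𝟙 (y₁ ≟F x₂) + 𝟙 (y₁ ≟F y₂))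
      ≡⟨ sym (𝟙-⊎₄ (x₁ ≟F x₂) (x₁ ≟F y₂) (y₁ ≟F x₂) (y₁ ≟F y₂) n₁₂ n₁₃ n₁₄ n₂₃ n₂₄ n₃₄) ⟩
    𝟙 (shareEnd? (ends e) (ends f)) ∎)
    where
    open ≡-Reasoning
    x₁ y₁ x₂ y₂ : Fin n
    x₁ = proj₁ (ends e)
    y₁ = proj₂ (ends e)
    x₂ = proj₁ (ends f)
    y₂ = proj₂ (ends f)
    expand : ∀ p q r s → (p + q) * (r + s) ≡ (p * r + p * s) + (q * r + q * s)
    expand = solve-∀
    meet : ∀ a b → ∑Fin n (λ u → 𝟙 (a ≟F u) * 𝟙 (b ≟F u)) ≡ 𝟙 (a ≟F b)
    meet a b = trans (∑Fin-δ n a (λ u → 𝟙 (b ≟F u))) (𝟙-iff (b ≟F a) (a ≟F b) sym sym)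
    n₁₂ : ¬ (x₁ ≡ x₂ × x₁ ≡ y₂)
    n₁₂ (p , q) = ends-distinct f (trans (sym p) q)
    n₁₃ : ¬ (x₁ ≡ x₂ × y₁ ≡ x₂)
    n₁₃ (p , q) = ends-distinct e (trans p (sym q))
    n₁₄ : ¬ (x₁ ≡ x₂ × y₁ ≡ y₂)
    n₁₄ (p , q) = e≢f (ends-injective (cong₂ _,_ p q))
    n₂₃ : ¬ (x₁ ≡ y₂ × y₁ ≡ x₂)
    n₂₃ (p , q) = FinP.<-asym (proj₁ (ends-edge e)) (subst₂ F._<_ (sym q) (sym p) (proj₁ (ends-edge f)))
    n₂₄ : ¬ (x₁ ≡ y₂ × y₁ ≡ y₂)
    n₂₄ (p , q) = ends-distinct e (trans p (sym q))
    n₃₄ : ¬ (y₁ ≡ x₂ × y₁ ≡ y₂)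
    n₃₄ (p , q) = ends-distinct f (trans (sym p) q)

  edge-determined : ∀ {u w e g} → u ≢ w → I u e ≡ 1 → I w e ≡ 1 → I u g ≡ 1 → I w g ≡ 1 → e ≡ g
  edge-determined {u} {w} {e} {g} u≢w ue we ug wg = ends-injective
    (same-ends (two-ends u≢w (𝟙≡1⇒ (u ∈ₑ? ends e) ue) (𝟙≡1⇒ (w ∈ₑ? ends e) we))
               (two-ends u≢w (𝟙≡1⇒ (u ∈ₑ? ends g) ug) (𝟙≡1⇒ (w ∈ₑ? ends g) wg)))
    where
    -- both edges list their ends in increasing order, so the orientations agree
    Orientation : Fin N → Set
    Orientation d = (proj₁ (ends d) ≡ u × proj₂ (ends d) ≡ w) ⊎ (proj₁ (ends d) ≡ w × proj₂ (ends d) ≡ u)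
    same-ends : Orientation e → Orientation g → ends e ≡ ends g
    same-ends (inj₁ (a₁ , b₁)) (inj₁ (a₂ , b₂)) = cong₂ _,_ (trans a₁ (sym a₂)) (trans b₁ (sym b₂))
    same-ends (inj₂ (a₁ , b₁)) (inj₂ (a₂ , b₂)) = cong₂ _,_ (trans a₁ (sym a₂)) (trans b₁ (sym b₂))
    same-ends (inj₁ (a₁ , b₁)) (inj₂ (a₂ , b₂)) =
      ⊥-elim (FinP.<-asym (subst₂ F._<_ a₁ b₁ (proj₁ (ends-edge e))) (subst₂ F._<_ a₂ b₂ (proj₁ (ends-edge g))))
    same-ends (inj₂ (a₁ , b₁)) (inj₁ (a₂ , b₂)) =
      ⊥-elim (FinP.<-asym (subst₂ F._<_ a₁ b₁ (proj₁ (ends-edge e))) (subst₂ F._<_ a₂ b₂ (proj₁ (ends-edge g))))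

  at-most-two-ends : ∀ {u v w e} → u ≢ v → v ≢ w → u ≢ w → I u e ≡ 1 → I v e ≡ 1 → I w e ≡ 1 → ⊥
  at-most-two-ends {u} {v} {w} {e} uv vw uw ue ve we =
    no-three-ends (ends e) uv vw uw (𝟙≡1⇒ (u ∈ₑ? ends e) ue) (𝟙≡1⇒ (v ∈ₑ? ends e) ve) (𝟙≡1⇒ (w ∈ₑ? ends e) we)

  adjL : Fin N → Fin N → ℕ
  adjL = adj (lineGraph G)

  common : Fin N → Fin N → ℕ
  common e f = ∑Fin n (λ u → I u e * I u f)

  adjL-by-incidence : ∀ e f → adjL e f ≡ ≢𝟙 e f * common e f
  adjL-by-incidence e f = trans (𝟙-× (¬? (e ≟F f)) (shareEnd? (ends e) (ends f)))
                                (bit-*-cong _ _ (≢𝟙-bit e f) (λ h → share-end (≢𝟙≡1⇒ h)))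

  corners : Fin N → Fin N → Fin N → Fin n → Fin n → Fin n → ℕ
  corners e f g u v w = (I u e * I u f) * ((I v f * I v g) * (I w e * I w g))

  corners-bit : ∀ e f g u v w → Bit (corners e f g u v w)
  corners-bit e f g u v w = bit-* (bit-* (I-bit u e) (I-bit u f))
                                  (bit-* (bit-* (I-bit v f) (I-bit v g)) (bit-* (I-bit w e) (I-bit w g)))

  Corners : Fin N → Fin N → Fin N → Fin n → Fin n → Fin n → Set
  Corners e f g u v w = (I u e ≡ 1 × I u f ≡ 1) × (I v f ≡ 1 × I v g ≡ 1) × (I w e ≡ 1 × I w g ≡ 1)

  corners≡1 : ∀ {e f g u v w} → corners e f g u v w ≡ 1 → Corners e f g u v w
  corners≡1 {e} {f} {g} {u} {v} {w} h =
    let (uef , vfg-weg) = *≡1 (I u e * I u f) _ h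
        (vfg , weg) = *≡1 (I v f * I v g) _ vfg-weg
    in *≡1 (I u e) _ uef , *≡1 (I v f) _ vfg , *≡1 (I w e) _ weg

  star-or-triangle-cases : ∀ {e f g u v w} → e ≢ f → f ≢ g → e ≢ g → Corners e f g u v w →
    𝟙 (u ≟F v) * 𝟙 (u ≟F w) + distinct u v w ≡ 1
  star-or-triangle-cases {e} {f} {g} {u} {v} {w} e≢f f≢g e≢g ((ue , uf) , (vf , vg) , (we , wg))
    with u ≟F v | v ≟F w | u ≟F w
  ... | yes _ | yes _ | yes _ = refl
  ... | yes p | yes q | no r = ⊥-elim (r (trans p q))
  ... | yes p | no q | yes r = ⊥-elim (q (trans (sym p) r))
  ... | yes refl | no _ | no r = ⊥-elim (e≢g (edge-determined r ue we vg wg))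
  ... | no p | yes q | yes r = ⊥-elim (p (trans r (sym q)))
  ... | no p | yes refl | no _ = ⊥-elim (e≢f (edge-determined p ue we uf vf))
  ... | no p | no _ | yes refl = ⊥-elim (f≢g (edge-determined p uf vf wg vg))
  ... | no _ | no _ | no _ = refl

  star-or-triangle : ∀ e f g u v w → distinct e f g * corners e f g u v w
    ≡ distinct e f g * corners e f g u v w * (𝟙 (u ≟F v) * 𝟙 (u ≟F w)) + distinct e f g * corners e f g u v w * distinct u v w
  star-or-triangle e f g u v w = begin
    D * C ≡⟨ sym (*-identityʳ (D * C)) ⟩
    D * C * 1 ≡⟨ bit-*-cong 1 (𝟙 (u ≟F v) * 𝟙 (u ≟F w) + distinct u v w) (bit-* (distinct-bit e f g) (corners-bit e f g u v w)) cases ⟩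
    D * C * (𝟙 (u ≟F v) * 𝟙 (u ≟F w) + distinct u v w) ≡⟨ *-distribˡ-+ (D * C) _ _ ⟩
    D * C * (𝟙 (u ≟F v) * 𝟙 (u ≟F w)) + D * C * distinct u v w ∎
    where
    open ≡-Reasoning
    D C : ℕ
    D = distinct e f g
    C = corners e f g u v w
    cases : D * C ≡ 1 → 1 ≡ 𝟙 (u ≟F v) * 𝟙 (u ≟F w) + distinct u v w
    cases h = let (d , c) = *≡1 D C h ; (ef , fg , eg) = distinct-≢ d
              in sym (star-or-triangle-cases ef fg eg (corners≡1 c))

  stars : ∀ e f g → ∑³ n (λ u v w → distinct e f g * corners e f g u v w * (𝟙 (u ≟F v) * 𝟙 (u ≟F w)))
                  ≡ ∑Fin n (λ u → distinct e f g * (I u e * (I u f * I u g)))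
  stars e f g = ∑Fin-cong n (λ u → begin
    ∑Fin n (λ v → ∑Fin n (λ w → D * corners e f g u v w * (𝟙 (u ≟F v) * 𝟙 (u ≟F w))))
      ≡⟨ ∑Fin-cong n (λ v → trans (∑Fin-cong n (λ w → regroup D (corners e f g u v w) (𝟙 (u ≟F v)) (𝟙 (u ≟F w))))
                                  (∑-*ˡ (allFin n) (𝟙 (u ≟F v)) (λ w → 𝟙 (u ≟F w) * (D * corners e f g u v w)))) ⟩
    ∑Fin n (λ v → 𝟙 (u ≟F v) * ∑Fin n (λ w → 𝟙 (u ≟F w) * (D * corners e f g u v w)))
      ≡⟨ ∑Fin-δ n u (λ v → ∑Fin n (λ w → 𝟙 (u ≟F w) * (D * corners e f g u v w))) ⟩
    ∑Fin n (λ w → 𝟙 (u ≟F w) * (D * corners e f g u u w)) ≡⟨ ∑Fin-δ n u (λ w → D * corners e f g u u w) ⟩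
    D * corners e f g u u u ≡⟨ cong (D *_) (corners-diagonal u) ⟩
    D * (I u e * (I u f * I u g)) ∎)
    where
    open ≡-Reasoning
    D : ℕ
    D = distinct e f g
    regroup : ∀ d c x y → d * c * (x * y) ≡ x * (y * (d * c))
    regroup = solve-∀
    corners-diagonal : ∀ u → corners e f g u u u ≡ I u e * (I u f * I u g)
    corners-diagonal u =
      trans (square-out (I u e) (I u f) (I u g))
            (cong₂ _*_ (bit-square (I-bit u e)) (cong₂ _*_ (bit-square (I-bit u f)) (bit-square (I-bit u g))))
      where square-out : ∀ p q t → (p * q) * ((q * t) * (p * t)) ≡ (p * p) * ((q * q) * (t * t))
            square-out = solve-∀

  adj≡1⇒≢ : ∀ {x y} → adj G x y ≡ 1 → x ≢ y
  adj≡1⇒≢ {x} h refl = adj-irr (𝟙≡1⇒ (adj? x x) h)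

  corners-distinct-edges : ∀ {u v w} → u ≢ v → v ≢ w → u ≢ w → ∀ e f g → corners e f g u v w ≡ 1 → distinct e f g ≡ 1
  corners-distinct-edges uv vw uw e f g h with corners≡1 {e} {f} {g} h
  ... | (ue , uf) , (vf , vg) , (we , wg) = distinct-intro {e = e} {f} {g}
    (λ { refl → at-most-two-ends uv vw uw ue vf we })
    (λ { refl → at-most-two-ends uv vw uw uf vf wg })
    (λ { refl → at-most-two-ends uv vw uw ue vg we })

  -- for distinct u, v, w the edges e ∋ u,w, f ∋ u,v, g ∋ v,w are determined, and exist iff
  -- the three sides are edges of G
  triangle-sides : ∀ u v w → distinct u v w ≡ 1 →
    ∑³ N (λ e f g → distinct e f g * corners e f g u v w) ≡ adj G u w * (adj G u v * adj G v w)
  triangle-sides u v w h = let (uv , vw , uw) = distinct-≢ h in begin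
    ∑³ N (λ e f g → distinct e f g * corners e f g u v w)
      ≡⟨ ∑³-cong N (λ e f g → bit-absorb (distinct e f g) (corners-bit e f g u v w) (corners-distinct-edges uv vw uw e f g)) ⟩
    ∑³ N (λ e f g → corners e f g u v w)
      ≡⟨ ∑³-cong N (λ e f g → regroup (I u e) (I u f) (I v f) (I v g) (I w e) (I w g)) ⟩
    ∑³ N (λ e f g → (I u e * I w e) * ((I u f * I v f) * (I v g * I w g)))
      ≡⟨ sym (∑³-product N (λ e → I u e * I w e) (λ f → I u f * I v f) (λ g → I v g * I w g)) ⟩
    ∑Fin N (λ e → I u e * I w e) * (∑Fin N (λ f → I u f * I v f) * ∑Fin N (λ g → I v g * I w g))
      ≡⟨ cong₂ _*_ (codegree uw) (cong₂ _*_ (codegree uv) (codegree vw)) ⟩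
    adj G u w * (adj G u v * adj G v w) ∎
    where
    open ≡-Reasoning
    regroup : ∀ p q x y s t → (p * q) * ((x * y) * (s * t)) ≡ (p * s) * ((q * x) * (y * t))
    regroup = solve-∀

  triangles : ∀ u v w → ∑³ N (λ e f g → distinct e f g * corners e f g u v w * distinct u v w) ≡ Δ G u v w
  triangles u v w = begin
    ∑³ N (λ e f g → distinct e f g * corners e f g u v w * D)
      ≡⟨ ∑³-cong N (λ e f g → *-comm (distinct e f g * corners e f g u v w) D) ⟩
    ∑³ N (λ e f g → D * (distinct e f g * corners e f g u v w)) ≡⟨ ∑³-*ˡ N D _ ⟩
    D * ∑³ N (λ e f g → distinct e f g * corners e f g u v w)
      ≡⟨ bit-*-cong _ _ (distinct-bit u v w) (triangle-sides u v w) ⟩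
    D * (adj G u w * (adj G u v * adj G v w))
      ≡⟨ bit-absorb D (bit-* (bit-𝟙 (adj? u w)) (bit-* (bit-𝟙 (adj? u v)) (bit-𝟙 (adj? v w)))) sides-distinct ⟩
    adj G u w * (adj G u v * adj G v w) ≡⟨ rotate (adj G u w) (adj G u v) (adj G v w) ⟩
    Δ G u v w ∎
    where
    open ≡-Reasoning
    D : ℕ
    D = distinct u v w
    rotate : ∀ x y z → x * (y * z) ≡ y * (z * x)
    rotate = solve-∀
    sides-distinct : adj G u w * (adj G u v * adj G v w) ≡ 1 → D ≡ 1
    sides-distinct h =
      let (uw , uv-vw) = *≡1 (adj G u w) _ h ; (uv , vw) = *≡1 (adj G u v) _ uv-vw
      in distinct-intro (adj≡1⇒≢ uv) (adj≡1⇒≢ vw) (adj≡1⇒≢ uw)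

  all-stars : ∑³ N (λ e f g → ∑³ n (λ u v w → distinct e f g * corners e f g u v w * (𝟙 (u ≟F v) * 𝟙 (u ≟F w))))
            ≡ n * (k * ((k ∸ 1) * (k ∸ 2)))
  all-stars = begin
    ∑³ N (λ e f g → ∑³ n (λ u v w → distinct e f g * corners e f g u v w * (𝟙 (u ≟F v) * 𝟙 (u ≟F w))))
      ≡⟨ ∑³-cong N stars ⟩
    ∑³ N (λ e f g → ∑Fin n (λ u → distinct e f g * (I u e * (I u f * I u g))))
      ≡⟨ sym (∑-∑³-swap (allFin n) N (λ u e f g → distinct e f g * (I u e * (I u f * I u g)))) ⟩
    ∑Fin n (λ u → ∑³ N (λ e f g → distinct e f g * (I u e * (I u f * I u g))))
      ≡⟨ ∑Fin-cong n (λ u → ∑-distinct-triples N (I u) (I-bit u) k (degree-by-edges u)) ⟩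
    ∑Fin n (λ u → k * ((k ∸ 1) * (k ∸ 2))) ≡⟨ ∑Fin-const n _ ⟩
    n * (k * ((k ∸ 1) * (k ∸ 2))) ∎
    where open ≡-Reasoning

  all-triangles : ∑³ N (λ e f g → ∑³ n (λ u v w → distinct e f g * corners e f g u v w * distinct u v w)) ≡ ∑³ n (Δ G)
  all-triangles = trans (∑³-∑³-swap N n _) (∑³-cong n triangles)

  ∑-Δ-lineGraph : ∑³ N (Δ (lineGraph G)) ≡ n * (k * ((k ∸ 1) * (k ∸ 2))) + ∑³ n (Δ G)
  ∑-Δ-lineGraph = begin
    ∑³ N (Δ (lineGraph G))
      ≡⟨ ∑³-cong N (λ e f g → trans (cong₂ _*_ (adjL-by-incidence e f) (cong₂ _*_ (adjL-by-incidence f g) (adjL-by-incidence e g)))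
                                    (regroup (≢𝟙 e f) (common e f) (≢𝟙 f g) (common f g) (≢𝟙 e g) (common e g))) ⟩
    ∑³ N (λ e f g → distinct e f g * (common e f * (common f g * common e g)))
      ≡⟨ ∑³-cong N (λ e f g → cong (distinct e f g *_)
           (∑³-product n (λ u → I u e * I u f) (λ v → I v f * I v g) (λ w → I w e * I w g))) ⟩
    ∑³ N (λ e f g → distinct e f g * ∑³ n (corners e f g))
      ≡⟨ ∑³-cong N (λ e f g → trans (sym (∑³-*ˡ n (distinct e f g) (corners e f g)))
                                    (trans (∑³-cong n (star-or-triangle e f g)) (∑³-+ n _ _))) ⟩
    ∑³ N (λ e f g → ∑³ n (λ u v w → distinct e f g * corners e f g u v w * (𝟙 (u ≟F v) * 𝟙 (u ≟F w)))
                  + ∑³ n (λ u v w → distinct e f g * corners e f g u v w * distinct u v w)) ≡⟨ ∑³-+ N _ _ ⟩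
    ∑³ N (λ e f g → ∑³ n (λ u v w → distinct e f g * corners e f g u v w * (𝟙 (u ≟F v) * 𝟙 (u ≟F w))))
      + ∑³ N (λ e f g → ∑³ n (λ u v w → distinct e f g * corners e f g u v w * distinct u v w))
      ≡⟨ cong₂ _+_ all-stars all-triangles ⟩
    n * (k * ((k ∸ 1) * (k ∸ 2))) + ∑³ n (Δ G) ∎
    where
    open ≡-Reasoning
    regroup : ∀ p x q y s z → (p * x) * ((q * y) * (s * z)) ≡ (p * (q * s)) * (x * (y * z))
    regroup = solve-∀

  six-n3-lineGraph : 6 * n3 (lineGraph G) ≡ n * (k * ((k ∸ 1) * (k ∸ 2))) + 6 * n3 G
  six-n3-lineGraph = begin
    6 * n3 (lineGraph G) ≡⟨ six-n3 (lineGraph G) lineGraph-sym (λ h → proj₁ h refl) ⟩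
    ∑³ N (Δ (lineGraph G)) ≡⟨ ∑-Δ-lineGraph ⟩
    n * (k * ((k ∸ 1) * (k ∸ 2))) + ∑³ n (Δ G) ≡⟨ cong (n * (k * ((k ∸ 1) * (k ∸ 2))) +_) (sym (six-n3 G adj-sym adj-irr)) ⟩
    n * (k * ((k ∸ 1) * (k ∸ 2))) + 6 * n3 G ∎
    where
    open ≡-Reasoning
    share-sym : ∀ {p q : Fin n × Fin n} → ShareEnd p q → ShareEnd q p
    share-sym (inj₁ x) = inj₁ (sym x)
    share-sym (inj₂ (inj₁ x)) = inj₂ (inj₂ (inj₁ (sym x)))
    share-sym (inj₂ (inj₂ (inj₁ x))) = inj₂ (inj₁ (sym x))
    share-sym (inj₂ (inj₂ (inj₂ x))) = inj₂ (inj₂ (inj₂ (sym x)))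
    lineGraph-sym : ∀ {e f} → FinGraph.Adj (lineGraph G) e f → FinGraph.Adj (lineGraph G) f e
    lineGraph-sym (e≢f , sh) = (λ x → e≢f (sym x)) , share-sym sh

-- Finite commutative rings: basic algebra, and existence of a maximal
-- ideal above every proper ideal (by enlarging I to I + Ry while possible).

module FiniteRing (R : FinCRing) where
  open import Level using (0ℓ)
  open import Data.Nat using (zero; suc; _+_; _<_)
  open import Data.Nat.Properties using (<-irrefl; ≤-trans; ≤-reflexive; +-suc; +-monoˡ-≤; +-identityʳ)
  open import Algebra.Bundles using (CommutativeRing)
  import Algebra.Properties.Ring as RingProperties
  import Algebra.Properties.AbelianGroup as AbelianGroupProperties
  import Algebra.Properties.Group as GroupProperties
  import Algebra.Properties.CommutativeSemigroup as CommutativeSemigroupProperties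
  open import Data.Fin.Subset using (Subset; _∈_; _∉_; _⊆_; ⊤; ∣_∣)
  open import Data.Fin.Subset.Properties using (_∈?_; ∈⊤; ⊆-antisym; p⊂q⇒∣p∣<∣q∣; ∣p∣≤n)
  import Data.Vec as Vec
  import Data.Vec.Properties as VecP
  open FinCRing R renaming (_+_ to infixl 6 _+ᵣ_; _*_ to infixl 7 _*ᵣ_; -_ to infix 8 -ᵣ_; 0# to 0ᵣ; 1# to 1ᵣ)

  commutativeRing : CommutativeRing 0ℓ 0ℓ
  commutativeRing = record { isCommutativeRing = isCommRing }

  module CR = CommutativeRing commutativeRing
  private
    module RP = RingProperties CR.ring
    module AGP = AbelianGroupProperties CR.+-abelianGroup
    module GP = GroupProperties CR.+-group
  open CommutativeSemigroupProperties CR.+-commutativeSemigroup using (interchange)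
  open ≡-Reasoning

  infixl 6 _⊖_
  _⊖_ : Carrier → Carrier → Carrier
  x ⊖ y = x +ᵣ (-ᵣ y)

  neg-zero : -ᵣ 0ᵣ ≡ 0ᵣ
  neg-zero = GP.ε⁻¹≈ε

  sub-zero : ∀ x → x ⊖ 0ᵣ ≡ x
  sub-zero x = trans (cong (x +ᵣ_) neg-zero) (CR.+-identityʳ x)

  sub≡0⇒≡ : ∀ x y → x ⊖ y ≡ 0ᵣ → x ≡ y
  sub≡0⇒≡ = GP.x∙y⁻¹≈ε⇒x≈y

  neg-sub : ∀ x y → -ᵣ (x ⊖ y) ≡ y ⊖ x
  neg-sub = AGP.⁻¹-anti-homo‿-

  neg-*-neg : ∀ x y → (-ᵣ x) *ᵣ (-ᵣ y) ≡ x *ᵣ y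
  neg-*-neg x y = begin
    (-ᵣ x) *ᵣ (-ᵣ y) ≡⟨ sym (RP.-‿distribˡ-* x (-ᵣ y)) ⟩
    -ᵣ (x *ᵣ (-ᵣ y)) ≡⟨ cong -ᵣ_ (sym (RP.-‿distribʳ-* x y)) ⟩
    -ᵣ (-ᵣ (x *ᵣ y)) ≡⟨ GP.⁻¹-involutive (x *ᵣ y) ⟩
    x *ᵣ y ∎

  sub-involutive : ∀ a b → a ⊖ (a ⊖ b) ≡ b
  sub-involutive a b = begin
    a +ᵣ (-ᵣ (a ⊖ b)) ≡⟨ cong (a +ᵣ_) (neg-sub a b) ⟩
    a +ᵣ (b +ᵣ -ᵣ a) ≡⟨ cong (a +ᵣ_) (CR.+-comm b (-ᵣ a)) ⟩
    a +ᵣ (-ᵣ a +ᵣ b) ≡⟨ sym (CR.+-assoc a (-ᵣ a) b) ⟩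
    (a +ᵣ -ᵣ a) +ᵣ b ≡⟨ cong (_+ᵣ b) (CR.-‿inverseʳ a) ⟩
    0ᵣ +ᵣ b ≡⟨ CR.+-identityˡ b ⟩
    b ∎

  sub-sub-cancel : ∀ a b c → (a ⊖ c) ⊖ (b ⊖ c) ≡ a ⊖ b
  sub-sub-cancel a b c = begin
    (a +ᵣ -ᵣ c) +ᵣ -ᵣ (b ⊖ c) ≡⟨ cong ((a +ᵣ -ᵣ c) +ᵣ_) (neg-sub b c) ⟩
    (a +ᵣ -ᵣ c) +ᵣ (c +ᵣ -ᵣ b) ≡⟨ CR.+-assoc a (-ᵣ c) (c +ᵣ -ᵣ b) ⟩
    a +ᵣ (-ᵣ c +ᵣ (c +ᵣ -ᵣ b)) ≡⟨ cong (a +ᵣ_) (sym (CR.+-assoc (-ᵣ c) c (-ᵣ b))) ⟩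
    a +ᵣ ((-ᵣ c +ᵣ c) +ᵣ -ᵣ b) ≡⟨ cong (λ t → a +ᵣ (t +ᵣ -ᵣ b)) (CR.-‿inverseˡ c) ⟩
    a +ᵣ (0ᵣ +ᵣ -ᵣ b) ≡⟨ cong (a +ᵣ_) (CR.+-identityˡ (-ᵣ b)) ⟩
    a ⊖ b ∎

  unit-sub-comm : ∀ a b → IsUnit (a ⊖ b) → IsUnit (b ⊖ a)
  unit-sub-comm a b (v , e) = -ᵣ v , trans (cong (_*ᵣ -ᵣ v) (sym (neg-sub a b))) (trans (neg-*-neg (a ⊖ b) v) e)

  not-unit-sub-self : ∀ a → ¬ IsUnit (a ⊖ a)
  not-unit-sub-self a (v , e) = 1≢0 (trans (sym e) (trans (cong (_*ᵣ v) (CR.-‿inverseʳ a)) (CR.zeroˡ v)))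

  one-sub-zero-unit : IsUnit (1ᵣ ⊖ 0ᵣ)
  one-sub-zero-unit = 1ᵣ , trans (cong (_*ᵣ 1ᵣ) (sub-zero 1ᵣ)) (CR.*-identityʳ 1ᵣ)

  toSubset : ∀ {P : Carrier → Set} → (∀ z → Dec (P z)) → Subset size
  toSubset P? = Vec.tabulate (λ z → does (P? z))

  toSubset⁻ : ∀ {P : Carrier → Set} (P? : ∀ z → Dec (P z)) {z} → z ∈ toSubset P? → P z
  toSubset⁻ P? {z} h with P? z | trans (sym (VecP.lookup∘tabulate (λ z → does (P? z)) z)) (VecP.[]=⇒lookup h)
  ... | yes p | _ = p
  ... | no _ | ()

  toSubset⁺ : ∀ {P : Carrier → Set} (P? : ∀ z → Dec (P z)) {z} → P z → z ∈ toSubset P?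
  toSubset⁺ {P} P? {z} p = VecP.lookup⇒[]= z (toSubset P?) (trans (VecP.lookup∘tabulate (λ z → does (P? z)) z) (does-yes (P? z)))
    where
    does-yes : (d : Dec (P z)) → does d ≡ true
    does-yes (yes _) = refl
    does-yes (no ¬p) = ⊥-elim (¬p p)

  InPlus : Subset size → Carrier → Carrier → Set
  InPlus I y z = Σ Carrier λ r → (z ⊖ r *ᵣ y) ∈ I

  inPlus? : ∀ I y z → Dec (InPlus I y z)
  inPlus? I y z = FinP.any? (λ r → (z ⊖ r *ᵣ y) ∈? I)

  _+R_ : Subset size → Carrier → Subset size
  I +R y = toSubset (inPlus? I y)

  module _ {I : Subset size} (I-ideal : IsIdeal I) (y : Carrier) where
    open IsIdeal I-ideal

    plus-intro : ∀ {z} r → (z ⊖ r *ᵣ y) ∈ I → z ∈ I +R y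
    plus-intro r p = toSubset⁺ (inPlus? I y) (r , p)

    plus-elim : ∀ {z} → z ∈ I +R y → InPlus I y z
    plus-elim = toSubset⁻ (inPlus? I y)

    +R-ideal : IsIdeal (I +R y)
    +R-ideal = record
      { 0∈ = plus-intro 0ᵣ (subst (_∈ I) (sym (drop-zero 0ᵣ)) 0∈)
      ; +-closed = λ h₁ h₂ → closed-+ (plus-elim h₁) (plus-elim h₂)
      ; neg-closed = λ h → closed-neg (plus-elim h)
      ; *-closed = λ s h → closed-* s (plus-elim h)
      }
      where
      drop-zero : ∀ z → z ⊖ 0ᵣ *ᵣ y ≡ z
      drop-zero z = trans (cong (z ⊖_) (CR.zeroˡ y)) (sub-zero z)
      closed-+ : ∀ {z₁ z₂} → InPlus I y z₁ → InPlus I y z₂ → (z₁ +ᵣ z₂) ∈ I +R y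
      closed-+ {z₁} {z₂} (r₁ , p₁) (r₂ , p₂) = plus-intro (r₁ +ᵣ r₂) (subst (_∈ I) (sym eq) (+-closed p₁ p₂))
        where
        eq : (z₁ +ᵣ z₂) ⊖ (r₁ +ᵣ r₂) *ᵣ y ≡ (z₁ ⊖ r₁ *ᵣ y) +ᵣ (z₂ ⊖ r₂ *ᵣ y)
        eq = begin
          (z₁ +ᵣ z₂) +ᵣ -ᵣ ((r₁ +ᵣ r₂) *ᵣ y) ≡⟨ cong (λ t → (z₁ +ᵣ z₂) +ᵣ -ᵣ t) (CR.distribʳ y r₁ r₂) ⟩
          (z₁ +ᵣ z₂) +ᵣ -ᵣ (r₁ *ᵣ y +ᵣ r₂ *ᵣ y) ≡⟨ cong ((z₁ +ᵣ z₂) +ᵣ_) (sym (AGP.⁻¹-∙-comm (r₁ *ᵣ y) (r₂ *ᵣ y))) ⟩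
          (z₁ +ᵣ z₂) +ᵣ (-ᵣ (r₁ *ᵣ y) +ᵣ -ᵣ (r₂ *ᵣ y)) ≡⟨ interchange z₁ z₂ (-ᵣ (r₁ *ᵣ y)) (-ᵣ (r₂ *ᵣ y)) ⟩
          (z₁ ⊖ r₁ *ᵣ y) +ᵣ (z₂ ⊖ r₂ *ᵣ y) ∎
      closed-neg : ∀ {z} → InPlus I y z → (-ᵣ z) ∈ I +R y
      closed-neg {z} (r , p) = plus-intro (-ᵣ r) (subst (_∈ I) (sym eq) (neg-closed p))
        where
        eq : (-ᵣ z) ⊖ (-ᵣ r) *ᵣ y ≡ -ᵣ (z ⊖ r *ᵣ y)
        eq = trans (cong (λ t → (-ᵣ z) +ᵣ -ᵣ t) (sym (RP.-‿distribˡ-* r y))) (AGP.⁻¹-∙-comm z (-ᵣ (r *ᵣ y)))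
      closed-* : ∀ s {z} → InPlus I y z → (s *ᵣ z) ∈ I +R y
      closed-* s {z} (r , p) = plus-intro (s *ᵣ r) (subst (_∈ I) (sym eq) (*-closed s p))
        where
        eq : (s *ᵣ z) ⊖ (s *ᵣ r) *ᵣ y ≡ s *ᵣ (z ⊖ r *ᵣ y)
        eq = begin
          (s *ᵣ z) +ᵣ -ᵣ ((s *ᵣ r) *ᵣ y) ≡⟨ cong (λ t → (s *ᵣ z) +ᵣ -ᵣ t) (CR.*-assoc s r y) ⟩
          (s *ᵣ z) +ᵣ -ᵣ (s *ᵣ (r *ᵣ y)) ≡⟨ cong ((s *ᵣ z) +ᵣ_) (RP.-‿distribʳ-* s (r *ᵣ y)) ⟩
          (s *ᵣ z) +ᵣ (s *ᵣ -ᵣ (r *ᵣ y)) ≡⟨ sym (CR.distribˡ s z (-ᵣ (r *ᵣ y))) ⟩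
          s *ᵣ (z ⊖ r *ᵣ y) ∎

    ⊆-+R : I ⊆ I +R y
    ⊆-+R {z} h = plus-intro 0ᵣ (subst (_∈ I) (sym (trans (cong (z ⊖_) (CR.zeroˡ y)) (sub-zero z))) h)

    ∈-+R : y ∈ I +R y
    ∈-+R = plus-intro 1ᵣ (subst (_∈ I) (sym y-1y) 0∈)
      where
      y-1y : y ⊖ 1ᵣ *ᵣ y ≡ 0ᵣ
      y-1y = trans (cong (y ⊖_) (CR.*-identityˡ y)) (CR.-‿inverseʳ y)

    +R-least : ∀ {J} → IsIdeal J → I ⊆ J → y ∈ J → I +R y ⊆ J
    +R-least {J} J-ideal I⊆J y∈J {z} h with plus-elim h
    ... | (r , p) = subst (_∈ J) (GP.//-rightDividesˡ (r *ᵣ y) z)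
                          (IsIdeal.+-closed J-ideal (I⊆J p) (IsIdeal.*-closed J-ideal r y∈J))

  one∈⇒⊤ : ∀ {J} → IsIdeal J → 1ᵣ ∈ J → J ≡ ⊤
  one∈⇒⊤ {J} J-ideal one = ⊆-antisym (λ _ → ∈⊤) (λ {z} _ → subst (_∈ J) (CR.*-identityʳ z) (IsIdeal.*-closed J-ideal z one))

  maximal-if-saturated : ∀ I → IsIdeal I → 1ᵣ ∉ I → (∀ y → ¬ (y ∉ I × 1ᵣ ∉ I +R y)) → IsMaximalIdeal I
  maximal-if-saturated I I-ideal 1∉I saturated = record
    { ideal = I-ideal ; proper = λ eq → 1∉I (subst (1ᵣ ∈_) (sym eq) ∈⊤) ; maximal = maximal }
    where
    maximal : ∀ J → IsIdeal J → I ⊆ J → J ≡ I ⊎ J ≡ ⊤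
    maximal J J-ideal I⊆J with FinP.any? (λ y → (y ∈? J) ×-dec ¬? (y ∈? I))
    ... | yes (y , y∈J , y∉I) = inj₂ (one∈⇒⊤ J-ideal (+R-least I-ideal y J-ideal I⊆J y∈J one∈))
      where
      one∈ : 1ᵣ ∈ I +R y
      one∈ with 1ᵣ ∈? (I +R y)
      ... | yes p = p
      ... | no q = ⊥-elim (saturated y (y∉I , q))
    ... | no none = inj₁ (⊆-antisym J⊆I I⊆J)
      where
      J⊆I : J ⊆ I
      J⊆I {z} z∈J with z ∈? I
      ... | yes p = p
      ... | no q = ⊥-elim (none (z , z∈J , q))

  -- every proper ideal lies in a maximal ideal; fuel f bounds the number of enlargements
  maximal-above : ∀ (f : ℕ) I → IsIdeal I → 1ᵣ ∉ I → size < ∣ I ∣ + f →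
    Σ (Subset size) λ J → IsMaximalIdeal J × I ⊆ J
  maximal-above zero I _ _ size<∣I∣ =
    ⊥-elim (<-irrefl refl (≤-trans size<∣I∣ (≤-trans (≤-reflexive (+-identityʳ ∣ I ∣)) (∣p∣≤n I))))
  maximal-above (suc f) I I-ideal 1∉I bound with FinP.any? (λ y → ¬? (y ∈? I) ×-dec ¬? (1ᵣ ∈? (I +R y)))
  ... | no saturated = I , maximal-if-saturated I I-ideal 1∉I (λ y h → saturated (y , h)) , (λ h → h)
  ... | yes (y , y∉I , 1∉I+Ry)
    with maximal-above f (I +R y) (+R-ideal I-ideal y) 1∉I+Ry
           (≤-trans bound (≤-trans (≤-reflexive (+-suc ∣ I ∣ f))
                                   (+-monoˡ-≤ f (p⊂q⇒∣p∣<∣q∣ (⊆-+R I-ideal y , y , ∈-+R I-ideal y , y∉I)))))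
  ... | (J , J-maximal , I+Ry⊆J) = J , J-maximal , (λ h → I+Ry⊆J (⊆-+R I-ideal y h))

-- In G_R two adjacent vertices
-- a, b have exactly |R| - 2m = |R^×| - m common neighbours, since c fails
-- to be a neighbour of both iff c lies in exactly one of the disjoint
-- cosets b + M and a + M.

module LocalRing (R : FinLocalRing) where
  open import Data.Nat using (zero; suc; _+_; _*_)
  open import Data.Nat.Properties using (≤-trans; n<1+n; m≤n+m; *-identityʳ; +-cancelʳ-≡; 0≢1+n)
  open import Data.Fin.Subset using (Subset; _∈_; _∉_; ∣_∣; ⁅_⁆)
  open import Data.Fin.Subset.Properties using (_∈?_; x∈⁅x⁆; x∈⁅y⁆⇒x≡y; drop-there)
  open import Data.Vec.Base using ([]; _∷_; there)
  open FinLocalRing R using (M; M-maximal; M-unique; m) renaming (ring to ring′)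
  open FinCRing ring′ renaming (_+_ to infixl 6 _+ᵣ_; _*_ to infixl 7 _*ᵣ_; -_ to infix 8 -ᵣ_; 0# to 0ᵣ; 1# to 1ᵣ)
  open FiniteRing ring′
  open Indicators
  open Sums
  open ≡-Reasoning

  ∣∣-as-∑ : ∀ {n} (p : Subset n) → ∣ p ∣ ≡ ∑Fin n (λ c → 𝟙 (c ∈? p))
  ∣∣-as-∑ [] = refl
  ∣∣-as-∑ {suc n} (b ∷ p) = begin
    ∣ b ∷ p ∣ ≡⟨ first-bit b ⟩
    𝟙 (zero ∈? (b ∷ p)) + ∣ p ∣
      ≡⟨ cong (𝟙 (zero ∈? (b ∷ p)) +_) (trans (∣∣-as-∑ p) (∑Fin-cong n (λ c → 𝟙-iff (c ∈? p) (suc c ∈? (b ∷ p)) there drop-there))) ⟩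
    𝟙 (zero ∈? (b ∷ p)) + ∑Fin n (λ c → 𝟙 (suc c ∈? (b ∷ p))) ≡⟨ sym (∑Fin-suc n (λ c → 𝟙 (c ∈? (b ∷ p)))) ⟩
    ∑Fin (suc n) (λ c → 𝟙 (c ∈? (b ∷ p))) ∎
    where
    first-bit : ∀ b → ∣ b ∷ p ∣ ≡ 𝟙 (zero ∈? (b ∷ p)) + ∣ p ∣
    first-bit true = refl
    first-bit false = refl

  M-ideal : IsIdeal M
  M-ideal = IsMaximalIdeal.ideal M-maximal

  zero-ideal : IsIdeal ⁅ 0ᵣ ⁆
  zero-ideal = record
    { 0∈ = x∈⁅x⁆ 0ᵣ
    ; +-closed = λ h₁ h₂ → is-zero (trans (cong₂ _+ᵣ_ (x∈⁅y⁆⇒x≡y 0ᵣ h₁) (x∈⁅y⁆⇒x≡y 0ᵣ h₂)) (CR.+-identityʳ 0ᵣ))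
    ; neg-closed = λ h → is-zero (trans (cong -ᵣ_ (x∈⁅y⁆⇒x≡y 0ᵣ h)) neg-zero)
    ; *-closed = λ r h → is-zero (trans (cong (r *ᵣ_) (x∈⁅y⁆⇒x≡y 0ᵣ h)) (CR.zeroʳ r))
    }
    where
    is-zero : ∀ {x} → x ≡ 0ᵣ → x ∈ ⁅ 0ᵣ ⁆
    is-zero refl = x∈⁅x⁆ 0ᵣ

  -- outside M every element is a unit: otherwise Rx is a proper ideal, contained in a
  -- maximal ideal, which is M by uniqueness
  unit-outside-M : ∀ x → x ∉ M → IsUnit x
  unit-outside-M x x∉M with isUnit? x
  ... | yes u = u
  ... | no ¬u with maximal-above (suc size) (⁅ 0ᵣ ⁆ +R x) (+R-ideal zero-ideal x) 1∉Rx
                     (≤-trans (n<1+n size) (m≤n+m (suc size) ∣ ⁅ 0ᵣ ⁆ +R x ∣))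
    where
    1∉Rx : 1ᵣ ∉ ⁅ 0ᵣ ⁆ +R x
    1∉Rx h with plus-elim zero-ideal x h
    ... | (r , p) = ¬u (r , trans (CR.*-comm x r) (sym (sub≡0⇒≡ 1ᵣ (r *ᵣ x) (x∈⁅y⁆⇒x≡y 0ᵣ p))))
  ... | (J , J-maximal , Rx⊆J) = ⊥-elim (x∉M (subst (x ∈_) (M-unique J J-maximal) (Rx⊆J (∈-+R zero-ideal x))))

  unit-outside-M⁻ : ∀ {x} → IsUnit x → x ∉ M
  unit-outside-M⁻ {x} (v , xv≡1) x∈M = IsMaximalIdeal.proper M-maximal
    (one∈⇒⊤ M-ideal (subst (_∈ M) (trans (CR.*-comm v x) xv≡1) (IsIdeal.*-closed M-ideal v x∈M)))

  U : Carrier → ℕ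
  U x = 𝟙 (isUnit? x)

  inM : Carrier → ℕ
  inM x = 𝟙 (x ∈? M)

  U-bit : ∀ x → Bit (U x)
  U-bit x = bit-𝟙 (isUnit? x)

  U-inside : ∀ {x} → x ∈ M → U x ≡ 0
  U-inside {x} h = 𝟙-no (isUnit? x) (λ u → unit-outside-M⁻ u h)

  U-outside : ∀ {x} → x ∉ M → U x ≡ 1
  U-outside {x} h = 𝟙-yes (isUnit? x) (unit-outside-M x h)

  U+inM : ∀ x → U x + inM x ≡ 1
  U+inM x with x ∈? M
  ... | yes p rewrite U-inside p = refl
  ... | no p rewrite U-outside p = refl

  unitCount-as-∑ : unitCount ≡ ∑Fin size U
  unitCount-as-∑ = length-filter-∑ isUnit? (allFin size)

  units+m : unitCount + m ≡ size
  units+m = begin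
    unitCount + m ≡⟨ cong₂ _+_ unitCount-as-∑ (∣∣-as-∑ M) ⟩
    ∑Fin size U + ∑Fin size inM ≡⟨ sym (∑-+ (allFin size) U inM) ⟩
    ∑Fin size (λ x → U x + inM x) ≡⟨ ∑Fin-cong size U+inM ⟩
    ∑Fin size (λ _ → 1) ≡⟨ ∑Fin-const size 1 ⟩
    size * 1 ≡⟨ *-identityʳ size ⟩
    size ∎

  unit-neighbours : ∀ a → ∑Fin size (λ b → U (a ⊖ b)) ≡ unitCount
  unit-neighbours a = trans (∑Fin-involution size (a ⊖_) (sub-involutive a) U) (sym unitCount-as-∑)

  M-translate : ∀ a → ∑Fin size (λ c → inM (a ⊖ c)) ≡ m
  M-translate a = trans (∑Fin-involution size (a ⊖_) (sub-involutive a) inM) (sym (∣∣-as-∑ M))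

  U-sub-comm : ∀ a b → U (a ⊖ b) ≡ U (b ⊖ a)
  U-sub-comm a b = 𝟙-iff (isUnit? (a ⊖ b)) (isUnit? (b ⊖ a)) (unit-sub-comm a b) (unit-sub-comm b a)

  common-or-coset : ∀ a b c → U (a ⊖ b) ≡ 1 → U (b ⊖ c) * U (a ⊖ c) + inM (b ⊖ c) + inM (a ⊖ c) ≡ 1
  common-or-coset a b c ab with (b ⊖ c) ∈? M | (a ⊖ c) ∈? M
  ... | yes p | yes q = ⊥-elim (0≢1+n (trans (sym (U-inside (subst (_∈ M) (sub-sub-cancel a b c) difference∈M))) ab))
    where
    difference∈M : ((a ⊖ c) ⊖ (b ⊖ c)) ∈ M
    difference∈M = IsIdeal.+-closed M-ideal q (IsIdeal.neg-closed M-ideal p)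
  ... | yes p | no _ rewrite U-inside p = refl
  ... | no p | yes q rewrite U-inside q | U-outside p = refl
  ... | no p | no q rewrite U-outside p | U-outside q = refl

  common-neighbours : ∀ a b → U (a ⊖ b) ≡ 1 → ∑Fin size (λ c → U (b ⊖ c) * U (a ⊖ c)) + m + m ≡ size
  common-neighbours a b ab = begin
    ∑Fin size (λ c → U (b ⊖ c) * U (a ⊖ c)) + m + m
      ≡⟨ cong₂ (λ x y → ∑Fin size (λ c → U (b ⊖ c) * U (a ⊖ c)) + x + y) (sym (M-translate b)) (sym (M-translate a)) ⟩
    ∑Fin size (λ c → U (b ⊖ c) * U (a ⊖ c)) + ∑Fin size (λ c → inM (b ⊖ c)) + ∑Fin size (λ c → inM (a ⊖ c))
      ≡⟨ cong (_+ ∑Fin size (λ c → inM (a ⊖ c))) (sym (∑-+ (allFin size) _ _)) ⟩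
    ∑Fin size (λ c → U (b ⊖ c) * U (a ⊖ c) + inM (b ⊖ c)) + ∑Fin size (λ c → inM (a ⊖ c))
      ≡⟨ sym (∑-+ (allFin size) _ _) ⟩
    ∑Fin size (λ c → U (b ⊖ c) * U (a ⊖ c) + inM (b ⊖ c) + inM (a ⊖ c)) ≡⟨ ∑Fin-cong size (λ c → common-or-coset a b c ab) ⟩
    ∑Fin size (λ _ → 1) ≡⟨ ∑Fin-const size 1 ⟩
    size * 1 ≡⟨ *-identityʳ size ⟩
    size ∎

  -- κ = |R^×| - m, the number of common neighbours of any two adjacent vertices (e.g. 1 and 0)
  κ : ℕ
  κ = ∑Fin size (λ c → U (0ᵣ ⊖ c) * U (1ᵣ ⊖ c))

  one-zero-adjacent : U (1ᵣ ⊖ 0ᵣ) ≡ 1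
  one-zero-adjacent = 𝟙-yes (isUnit? (1ᵣ ⊖ 0ᵣ)) one-sub-zero-unit

  κ+m : κ + m ≡ unitCount
  κ+m = +-cancelʳ-≡ m (κ + m) unitCount (trans (common-neighbours 1ᵣ 0ᵣ one-zero-adjacent) (sym units+m))

  common-neighbours-κ : ∀ a b → U (a ⊖ b) ≡ 1 → ∑Fin size (λ c → U (b ⊖ c) * U (a ⊖ c)) ≡ κ
  common-neighbours-κ a b ab = +-cancelʳ-≡ m _ κ (+-cancelʳ-≡ m _ (κ + m)
    (trans (common-neighbours a b ab) (sym (common-neighbours 1ᵣ 0ᵣ one-zero-adjacent))))

  ordered-triangles : ∑³ size (λ a b c → U (a ⊖ b) * (U (b ⊖ c) * U (a ⊖ c))) ≡ size * (unitCount * κ)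
  ordered-triangles = begin
    ∑³ size (λ a b c → U (a ⊖ b) * (U (b ⊖ c) * U (a ⊖ c)))
      ≡⟨ ∑Fin-cong size (λ a → ∑Fin-cong size (λ b →
           trans (∑-*ˡ (allFin size) (U (a ⊖ b)) (λ c → U (b ⊖ c) * U (a ⊖ c)))
                 (bit-*-cong _ κ (U-bit (a ⊖ b)) (common-neighbours-κ a b)))) ⟩
    ∑Fin size (λ a → ∑Fin size (λ b → U (a ⊖ b) * κ))
      ≡⟨ ∑Fin-cong size (λ a → trans (∑-*ʳ (allFin size) κ (λ b → U (a ⊖ b))) (cong (_* κ) (unit-neighbours a))) ⟩
    ∑Fin size (λ a → unitCount * κ) ≡⟨ ∑Fin-const size _ ⟩
    size * (unitCount * κ) ∎

-- The product ring R = R₁ × ⋯ × R_s: an element is a unit iff all its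
-- components are, so |R|, |R^×| and the number of ordered triangles of G_R
-- are products of the corresponding quantities of the factors.

module ProductRing where
  open import Data.Nat using (_*_)
  open import Data.Nat.Tactic.RingSolver using (solve-∀)
  open Indicators
  open Sums
  open ≡-Reasoning

  sub : (R : FinLocalRing) → Fin (sz R) → Fin (sz R) → Fin (sz R)
  sub R = FiniteRing._⊖_ (FinLocalRing.ring R)

  U : (R : FinLocalRing) → Fin (sz R) → ℕ
  U R = LocalRing.U R

  unitCount : FinLocalRing → ℕ
  unitCount R = FinCRing.unitCount (FinLocalRing.ring R)

  ∑E : ∀ Rs → (Elt Rs → ℕ) → ℕ
  ∑E Rs = ∑ (elts Rs)

  ∑E-cons : ∀ R Rs (h : Elt (R ∷ Rs) → ℕ) → ∑E (R ∷ Rs) h ≡ ∑Fin (sz R) (λ a → ∑E Rs (λ x → h (a ∷ x)))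
  ∑E-cons R Rs h = trans (∑-concatMap (λ a → map (a ∷_) (elts Rs)) (allFin (sz R)) h)
                         (∑Fin-cong (sz R) (λ a → ∑-map (a ∷_) (elts Rs) h))

  UP : ∀ {Rs} → Elt Rs → ℕ
  UP x = 𝟙 (isUnitP? x)

  UP-cons : ∀ {R Rs} (a : Fin (sz R)) (x : Elt Rs) → UP {R ∷ Rs} (a ∷ x) ≡ U R a * UP x
  UP-cons {R} {Rs} a x =
    trans (𝟙-iff (isUnitP? {R ∷ Rs} (a ∷ x)) (FinCRing.isUnit? (FinLocalRing.ring R) a ×-dec isUnitP? x) split join)
          (𝟙-× (FinCRing.isUnit? (FinLocalRing.ring R) a) (isUnitP? x))
    where
    head : Elt (R ∷ Rs) → Fin (sz R)
    head (b ∷ _) = b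
    tail : Elt (R ∷ Rs) → Elt Rs
    tail (_ ∷ y) = y
    split : IsUnitP {R ∷ Rs} (a ∷ x) → FinCRing.IsUnit (FinLocalRing.ring R) a × IsUnitP x
    split (b ∷ y , eq) = (b , cong head eq) , (y , cong tail eq)
    join : FinCRing.IsUnit (FinLocalRing.ring R) a × IsUnitP x → IsUnitP {R ∷ Rs} (a ∷ x)
    join ((b , e₁) , (y , e₂)) = b ∷ y , cong₂ _∷_ e₁ e₂

  units-as-∑ : ∀ Rs → unitsR Rs ≡ ∑E Rs UP
  units-as-∑ Rs = length-filter-∑ isUnitP? (elts Rs)

  cardR-cons : ∀ R Rs → cardR (R ∷ Rs) ≡ sz R * cardR Rs
  cardR-cons R Rs = begin
    cardR (R ∷ Rs) ≡⟨ length-∑ (elts (R ∷ Rs)) ⟩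
    ∑E (R ∷ Rs) (λ _ → 1) ≡⟨ ∑E-cons R Rs (λ _ → 1) ⟩
    ∑Fin (sz R) (λ _ → ∑E Rs (λ _ → 1)) ≡⟨ ∑Fin-const (sz R) _ ⟩
    sz R * ∑E Rs (λ _ → 1) ≡⟨ cong (sz R *_) (sym (length-∑ (elts Rs))) ⟩
    sz R * cardR Rs ∎

  ∑E-cons-* : ∀ R Rs (f : Fin (sz R) → ℕ) (h : Elt Rs → ℕ) →
    ∑Fin (sz R) (λ a → ∑E Rs (λ x → f a * h x)) ≡ ∑Fin (sz R) f * ∑E Rs h
  ∑E-cons-* R Rs f h = sym (∑-product (allFin (sz R)) (elts Rs) f h)

  units-cons : ∀ R Rs → unitsR (R ∷ Rs) ≡ unitCount R * unitsR Rs
  units-cons R Rs = begin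
    unitsR (R ∷ Rs) ≡⟨ units-as-∑ (R ∷ Rs) ⟩
    ∑E (R ∷ Rs) UP ≡⟨ ∑E-cons R Rs UP ⟩
    ∑Fin (sz R) (λ a → ∑E Rs (λ x → UP {R ∷ Rs} (a ∷ x))) ≡⟨ ∑Fin-cong (sz R) (λ a → ∑-cong (elts Rs) (UP-cons a)) ⟩
    ∑Fin (sz R) (λ a → ∑E Rs (λ x → U R a * UP x)) ≡⟨ ∑E-cons-* R Rs (U R) UP ⟩
    ∑Fin (sz R) (U R) * ∑E Rs UP ≡⟨ cong₂ _*_ (sym (LocalRing.unitCount-as-∑ R)) (sym (units-as-∑ Rs)) ⟩
    unitCount R * unitsR Rs ∎

  unit-neighbours : ∀ Rs (x : Elt Rs) → ∑E Rs (λ y → UP (subP x y)) ≡ unitsR Rs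
  unit-neighbours [] [] = refl
  unit-neighbours (R ∷ Rs) (a ∷ x) = begin
    ∑E (R ∷ Rs) (λ y → UP (subP (a ∷ x) y)) ≡⟨ ∑E-cons R Rs _ ⟩
    ∑Fin (sz R) (λ b → ∑E Rs (λ y → UP {R ∷ Rs} (sub R a b ∷ subP x y)))
      ≡⟨ ∑Fin-cong (sz R) (λ b → ∑-cong (elts Rs) (λ y → UP-cons (sub R a b) (subP x y))) ⟩
    ∑Fin (sz R) (λ b → ∑E Rs (λ y → U R (sub R a b) * UP (subP x y))) ≡⟨ ∑E-cons-* R Rs _ _ ⟩
    ∑Fin (sz R) (λ b → U R (sub R a b)) * ∑E Rs (λ y → UP (subP x y))
      ≡⟨ cong₂ _*_ (LocalRing.unit-neighbours R a) (unit-neighbours Rs x) ⟩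
    unitCount R * unitsR Rs ≡⟨ sym (units-cons R Rs) ⟩
    unitsR (R ∷ Rs) ∎

  UP-sub-comm : ∀ Rs (x y : Elt Rs) → UP (subP x y) ≡ UP (subP y x)
  UP-sub-comm [] [] [] = refl
  UP-sub-comm (R ∷ Rs) (a ∷ x) (b ∷ y) =
    trans (UP-cons (sub R a b) (subP x y))
          (trans (cong₂ _*_ (LocalRing.U-sub-comm R a b) (UP-sub-comm Rs x y)) (sym (UP-cons (sub R b a) (subP y x))))

  UP-sub-self : ∀ R Rs (x : Elt (R ∷ Rs)) → UP (subP x x) ≡ 0
  UP-sub-self R Rs (a ∷ x) =
    trans (UP-cons (sub R a a) (subP x x))
          (cong (_* UP (subP x x)) (𝟙-no (FinCRing.isUnit? (FinLocalRing.ring R) (sub R a a))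
                                          (FiniteRing.not-unit-sub-self (FinLocalRing.ring R) a)))

  Φ : ∀ {Rs} → Elt Rs → Elt Rs → Elt Rs → ℕ
  Φ x y z = UP (subP x y) * (UP (subP y z) * UP (subP x z))

  triangleCount : List FinLocalRing → ℕ
  triangleCount Rs = ∑E Rs (λ x → ∑E Rs (λ y → ∑E Rs (Φ x y)))

  κ-product : List FinLocalRing → ℕ
  κ-product [] = 1
  κ-product (R ∷ Rs) = LocalRing.κ R * κ-product Rs

  ∑³-separate : ∀ {A : Set} (xs : List A) m (F : Fin m → Fin m → Fin m → ℕ) (H : A → A → A → ℕ) →
    ∑Fin m (λ a → ∑ xs (λ x → ∑Fin m (λ b → ∑ xs (λ y → ∑Fin m (λ c → ∑ xs (λ z → F a b c * H x y z))))))
      ≡ ∑³ m F * ∑ xs (λ x → ∑ xs (λ y → ∑ xs (H x y)))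
  ∑³-separate xs m F H = begin
    ∑Fin m (λ a → ∑ xs (λ x → ∑Fin m (λ b → ∑ xs (λ y → ∑Fin m (λ c → ∑ xs (λ z → F a b c * H x y z))))))
      ≡⟨ ∑Fin-cong m (λ a → ∑-cong xs (λ x → ∑Fin-cong m (λ b → ∑-cong xs (λ y → sym (∑-product (allFin m) xs (F a b) (H x y)))))) ⟩
    ∑Fin m (λ a → ∑ xs (λ x → ∑Fin m (λ b → ∑ xs (λ y → ∑Fin m (F a b) * ∑ xs (H x y)))))
      ≡⟨ ∑Fin-cong m (λ a → ∑-cong xs (λ x → sym (∑-product (allFin m) xs (λ b → ∑Fin m (F a b)) (λ y → ∑ xs (H x y))))) ⟩
    ∑Fin m (λ a → ∑ xs (λ x → ∑Fin m (λ b → ∑Fin m (F a b)) * ∑ xs (λ y → ∑ xs (H x y))))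
      ≡⟨ sym (∑-product (allFin m) xs (λ a → ∑Fin m (λ b → ∑Fin m (F a b))) (λ x → ∑ xs (λ y → ∑ xs (H x y)))) ⟩
    ∑³ m F * ∑ xs (λ x → ∑ xs (λ y → ∑ xs (H x y))) ∎

  triangleCount-cons : ∀ R Rs → triangleCount (R ∷ Rs)
    ≡ ∑³ (sz R) (λ a b c → U R (sub R a b) * (U R (sub R b c) * U R (sub R a c))) * triangleCount Rs
  triangleCount-cons R Rs = begin
    triangleCount (R ∷ Rs)
      ≡⟨ trans (∑E-cons R Rs _) (∑Fin-cong (sz R) (λ a → ∑-cong (elts Rs) (λ x →
           trans (∑E-cons R Rs _) (∑Fin-cong (sz R) (λ b → ∑-cong (elts Rs) (λ y →
             trans (∑E-cons R Rs _) (∑Fin-cong (sz R) (λ c → ∑-cong (elts Rs) (λ z → componentwise a b c x y z))))))))) ⟩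
    ∑Fin (sz R) (λ a → ∑E Rs (λ x → ∑Fin (sz R) (λ b → ∑E Rs (λ y → ∑Fin (sz R) (λ c → ∑E Rs (λ z → F a b c * Φ x y z))))))
      ≡⟨ ∑³-separate (elts Rs) (sz R) F Φ ⟩
    ∑³ (sz R) F * triangleCount Rs ∎
    where
    F : Fin (sz R) → Fin (sz R) → Fin (sz R) → ℕ
    F a b c = U R (sub R a b) * (U R (sub R b c) * U R (sub R a c))
    regroup : ∀ p q s t u v → (p * q) * ((s * t) * (u * v)) ≡ (p * (s * u)) * (q * (t * v))
    regroup = solve-∀
    componentwise : ∀ a b c x y z → Φ {R ∷ Rs} (a ∷ x) (b ∷ y) (c ∷ z) ≡ F a b c * Φ x y z
    componentwise a b c x y z =
      trans (cong₂ _*_ (UP-cons (sub R a b) (subP x y)) (cong₂ _*_ (UP-cons (sub R b c) (subP y z)) (UP-cons (sub R a c) (subP x z))))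
            (regroup (U R (sub R a b)) (UP (subP x y)) (U R (sub R b c)) (UP (subP y z)) (U R (sub R a c)) (UP (subP x z)))

  triangleCount-formula : ∀ Rs → triangleCount Rs ≡ cardR Rs * (unitsR Rs * κ-product Rs)
  triangleCount-formula [] = refl
  triangleCount-formula (R ∷ Rs) = begin
    triangleCount (R ∷ Rs) ≡⟨ triangleCount-cons R Rs ⟩
    ∑³ (sz R) (λ a b c → U R (sub R a b) * (U R (sub R b c) * U R (sub R a c))) * triangleCount Rs
      ≡⟨ cong₂ _*_ (LocalRing.ordered-triangles R) (triangleCount-formula Rs) ⟩
    (sz R * (unitCount R * LocalRing.κ R)) * (cardR Rs * (unitsR Rs * κ-product Rs))
      ≡⟨ regroup (sz R) (unitCount R) (LocalRing.κ R) (cardR Rs) (unitsR Rs) (κ-product Rs) ⟩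
    (sz R * cardR Rs) * ((unitCount R * unitsR Rs) * (LocalRing.κ R * κ-product Rs))
      ≡⟨ sym (cong₂ (λ p q → p * (q * κ-product (R ∷ Rs))) (cardR-cons R Rs) (units-cons R Rs)) ⟩
    cardR (R ∷ Rs) * (unitsR (R ∷ Rs) * κ-product (R ∷ Rs)) ∎
    where
    regroup : ∀ s k x c u p → (s * (k * x)) * (c * (u * p)) ≡ (s * c) * ((k * u) * (x * p))
    regroup = solve-∀

module UnitaryCayleyGraph (R : FinLocalRing) (Rs′ : List FinLocalRing) where
  open import Data.Nat using (_+_; _*_; _∸_)
  open import Data.Nat.Properties using (0≢1+n)
  open Indicators
  open Sums
  open ProductRing
  open OrderedTriangles using (adj; Δ; six-n3)

  Rs : List FinLocalRing
  Rs = R ∷ Rs′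

  G : FinGraph
  G = unitaryCayley Rs

  element : Fin (cardR Rs) → Elt Rs
  element = lookup (elts Rs)

  adj-sym : ∀ {i j} → FinGraph.Adj G i j → FinGraph.Adj G j i
  adj-sym {i} {j} h =
    𝟙≡1⇒ (FinGraph.adj? G j i) (trans (sym (UP-sub-comm Rs (element i) (element j))) (𝟙-yes (FinGraph.adj? G i j) h))

  adj-irr : ∀ {i} → ¬ FinGraph.Adj G i i
  adj-irr {i} h = 0≢1+n (trans (sym (UP-sub-self R Rs′ (element i))) (𝟙-yes (FinGraph.adj? G i i) h))

  regular : ∀ i → ∑Fin (cardR Rs) (adj G i) ≡ unitsR Rs
  regular i = trans (∑Fin-lookup (elts Rs) (λ y → UP (subP (element i) y))) (unit-neighbours Rs (element i))

  ∑Δ≡triangleCount : ∑³ (cardR Rs) (Δ G) ≡ triangleCount Rs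
  ∑Δ≡triangleCount =
    trans (∑Fin-cong (cardR Rs) (λ i → ∑Fin-cong (cardR Rs) (λ j → ∑Fin-lookup (elts Rs) (Φ (element i) (element j)))))
          (trans (∑Fin-cong (cardR Rs) (λ i → ∑Fin-lookup (elts Rs) (λ y → ∑E Rs (Φ (element i) y))))
                 (∑Fin-lookup (elts Rs) (λ x → ∑E Rs (λ y → ∑E Rs (Φ x y)))))

  six-n3-cayley : 6 * n3 G ≡ cardR Rs * (unitsR Rs * κ-product Rs)
  six-n3-cayley = trans (six-n3 G adj-sym adj-irr) (trans ∑Δ≡triangleCount (triangleCount-formula Rs))

  six-n3-line : 6 * n3 (lineGraph G)
    ≡ cardR Rs * (unitsR Rs * ((unitsR Rs ∸ 1) * (unitsR Rs ∸ 2))) + cardR Rs * (unitsR Rs * κ-product Rs)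
  six-n3-line = trans (LineGraphTriangles.six-n3-lineGraph G adj-sym adj-irr (unitsR Rs) regular)
                      (cong (cardR Rs * (unitsR Rs * ((unitsR Rs ∸ 1) * (unitsR Rs ∸ 2))) +_) six-n3-cayley)

open import Data.Nat using (_≤_)
open import Data.List.Relation.Unary.Linked using (Linked)
open import Data.Integer using (+_; _*_; _+_; _-_)
import Data.Integer.Properties as ℤP
open import Data.Integer.Tactic.RingSolver using (solve-∀)
import Data.Nat as ℕ
open ≡-Reasoning

prodTerm≡κ-product : ∀ Rs → prodTerm Rs ≡ + ProductRing.κ-product Rs
prodTerm≡κ-product [] = refl
prodTerm≡κ-product (R ∷ Rs) =
  trans (cong₂ _*_ factor (prodTerm≡κ-product Rs)) (sym (ℤP.pos-* (LocalRing.κ R) (ProductRing.κ-product Rs)))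
  where
  cancel : ∀ x m → (x + m) - m ≡ x
  cancel = solve-∀
  factor : + FinCRing.unitCount (FinLocalRing.ring R) - + FinLocalRing.m R ≡ + LocalRing.κ R
  factor = trans (cong (_- + FinLocalRing.m R) (trans (cong +_ (sym (LocalRing.κ+m R))) (ℤP.pos-+ (LocalRing.κ R) (FinLocalRing.m R))))
                 (cancel (+ LocalRing.κ R) (+ FinLocalRing.m R))

-- u(u-1)(u-2) with truncated subtraction is the integer u(u-1)(u-2)
falling-factorial : ∀ u → + (u ℕ.* ((u ℕ.∸ 1) ℕ.* (u ℕ.∸ 2))) ≡ + u * ((+ u - + 1) * (+ u - + 2))
falling-factorial 0 = refl
falling-factorial 1 = refl
falling-factorial (ℕ.suc (ℕ.suc w)) = begin
  + (ℕ.suc (ℕ.suc w) ℕ.* (ℕ.suc w ℕ.* w)) ≡⟨ trans (ℤP.pos-* (ℕ.suc (ℕ.suc w)) (ℕ.suc w ℕ.* w)) (cong (+ ℕ.suc (ℕ.suc w) *_) (ℤP.pos-* (ℕ.suc w) w)) ⟩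
  + ℕ.suc (ℕ.suc w) * (+ ℕ.suc w * + w) ≡⟨ cong₂ (λ a b → a * (b * + w)) (ℤP.pos-+ 2 w) (ℤP.pos-+ 1 w) ⟩
  (+ 2 + + w) * ((+ 1 + + w) * + w) ≡⟨ shift (+ w) ⟩
  (+ 2 + + w) * (((+ 2 + + w) - + 1) * ((+ 2 + + w) - + 2)) ≡⟨ cong (λ a → a * ((a - + 1) * (a - + 2))) (sym (ℤP.pos-+ 2 w)) ⟩
  + ℕ.suc (ℕ.suc w) * ((+ ℕ.suc (ℕ.suc w) - + 1) * (+ ℕ.suc (ℕ.suc w) - + 2)) ∎
  where
  shift : ∀ w → (+ 2 + w) * ((+ 1 + w) * w) ≡ (+ 2 + w) * (((+ 2 + w) - + 1) * ((+ 2 + w) - + 2))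
  shift = solve-∀

corollary6p3 : (Rs : List FinLocalRing) → 1 ≤ length Rs → Linked RatioLE Rs →
    ((+ 6) * (+ n3 (unitaryCayley Rs))
        ≡ (+ unitsR Rs) * (+ cardR Rs) * prodTerm Rs)
    × ((+ 6) * (+ n3 (lineGraph (unitaryCayley Rs)))
        ≡ (+ unitsR Rs) * (+ cardR Rs)
            * (prodTerm Rs + ((+ unitsR Rs) - + 1) * ((+ unitsR Rs) - + 2)))
corollary6p3 [] () _
corollary6p3 Rs@(R ∷ Rs′) _ _ = triangles , line-triangles
  where
  open UnitaryCayleyGraph R Rs′ using (G; six-n3-cayley; six-n3-line)
  u c κ : ℕ
  u = unitsR Rs
  c = cardR Rs
  κ = ProductRing.κ-product Rs
  rearrange₁ : ∀ c u p → c * (u * p) ≡ u * c * p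
  rearrange₁ = solve-∀
  rearrange₂ : ∀ c u d p → c * (u * d) + c * (u * p) ≡ u * c * (p + d)
  rearrange₂ = solve-∀
  triangles : + 6 * + n3 G ≡ + u * + c * prodTerm Rs
  triangles = begin
    + 6 * + n3 G ≡⟨ sym (ℤP.pos-* 6 (n3 G)) ⟩
    + (6 ℕ.* n3 G) ≡⟨ cong +_ six-n3-cayley ⟩
    + (c ℕ.* (u ℕ.* κ)) ≡⟨ trans (ℤP.pos-* c _) (cong (+ c *_) (ℤP.pos-* u κ)) ⟩
    + c * (+ u * + κ) ≡⟨ rearrange₁ (+ c) (+ u) (+ κ) ⟩
    + u * + c * + κ ≡⟨ cong (+ u * + c *_) (sym (prodTerm≡κ-product Rs)) ⟩
    + u * + c * prodTerm Rs ∎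
  line-triangles : + 6 * + n3 (lineGraph G) ≡ + u * + c * (prodTerm Rs + (+ u - + 1) * (+ u - + 2))
  line-triangles = begin
    + 6 * + n3 (lineGraph G) ≡⟨ sym (ℤP.pos-* 6 (n3 (lineGraph G))) ⟩
    + (6 ℕ.* n3 (lineGraph G)) ≡⟨ cong +_ six-n3-line ⟩
    + (c ℕ.* (u ℕ.* ((u ℕ.∸ 1) ℕ.* (u ℕ.∸ 2))) ℕ.+ c ℕ.* (u ℕ.* κ)) ≡⟨ ℤP.pos-+ (c ℕ.* (u ℕ.* ((u ℕ.∸ 1) ℕ.* (u ℕ.∸ 2)))) (c ℕ.* (u ℕ.* κ)) ⟩
    + (c ℕ.* (u ℕ.* ((u ℕ.∸ 1) ℕ.* (u ℕ.∸ 2)))) + + (c ℕ.* (u ℕ.* κ))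
      ≡⟨ cong₂ _+_ (trans (ℤP.pos-* c _) (cong (+ c *_) (falling-factorial u)))
                   (trans (ℤP.pos-* c _) (cong (+ c *_) (ℤP.pos-* u κ))) ⟩
    + c * (+ u * ((+ u - + 1) * (+ u - + 2))) + + c * (+ u * + κ) ≡⟨ rearrange₂ (+ c) (+ u) _ (+ κ) ⟩
    + u * + c * (+ κ + (+ u - + 1) * (+ u - + 2)) ≡⟨ cong (λ t → + u * + c * (t + (+ u - + 1) * (+ u - + 2))) (sym (prodTerm≡κ-product Rs)) ⟩
    + u * + c * (prodTerm Rs + (+ u - + 1) * (+ u - + 2)) ∎
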